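{- For every positive integer $f$ and for all $n$ and sizes of $S,T$, there exist an undirected unweighted $n$-node graph $G=(V,E)$ and subsets $S,T\subseteq V$ such that every $(2f)$-FT $1$-additive $S\times T$ spanner (hence every $(2f)$-FT $S\times T$ preserver) of $G$ has $\Omega\left(|S|^{1/(f+1)}\cdot|T|^{1/(f+1)}\cdot (n/f)^{2-2/(f+1)}\right)$ edges.
   Context: For a graph $G=(V,E)$ and $P\subseteq V\times V$, a subgraph $H\subseteq G$ is an $f'$-FT $\beta$-additive $P$-pairwise spanner if $\mathrm{dist}_{H\setminus F}(s,t)\leq \mathrm{dist}_{G\setminus F}(s,t)+\beta$ for all $(s,t)\in P$ and all $F\subseteq E$ with $|F|\leq f'$; a preserver is the case $\beta=0$. An $S\times T$ spanner is the case $P=S\times T$. -}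

module Defs where

open import Data.Nat using (ℕ; zero; suc; _+_; _≤_; _<_)
open import Data.Fin using (Fin; toℕ)
open import Data.Fin.Subset using (Subset) renaming (_∈_ to _∈ₛ_)
open import Data.List using (List; length)
open import Data.List.Membership.Propositional using (_∈_; _∉_)
open import Data.List.Relation.Unary.All using (All)
open import Data.List.Relation.Unary.Unique.Propositional using (Unique)
open import Data.Product using (_×_; _,_; proj₁; proj₂; ∃)
open import Data.Sum using (_⊎_)

Edge : ℕ → Set
Edge n = Fin n × Fin n

-- Undirected unweighted simple graph on V = Fin n: a duplicate-free list of
-- edges {u,v}, each stored once as (u , v) with u < v (no loops).
record Graph (n : ℕ) : Set where
  field
    edges   : List (Edge n)
    ordered : All (λ e → toℕ (proj₁ e) < toℕ (proj₂ e)) edges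
    unique  : Unique edges
open Graph public

∣E∣ : ∀ {n} → Graph n → ℕ
∣E∣ G = length (edges G)

_⊆G_ : ∀ {n} → Graph n → Graph n → Set
H ⊆G G = ∀ {e} → e ∈ edges H → e ∈ edges G

EdgeIn : ∀ {n} → Graph n → List (Edge n) → Edge n → Set
EdgeIn G F e = (e ∈ edges G) × (e ∉ F)

Adj : ∀ {n} → Graph n → List (Edge n) → Fin n → Fin n → Set
Adj G F u v = EdgeIn G F (u , v) ⊎ EdgeIn G F (v , u)

data Walk {n : ℕ} (A : Fin n → Fin n → Set) : Fin n → Fin n → ℕ → Set where
  here : ∀ {u} → Walk A u u 0
  step : ∀ {u v w k} → A u v → Walk A v w k → Walk A u w (suc k)

DistLe : ∀ {n} → Graph n → List (Edge n) → Fin n → Fin n → ℕ → Set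
DistLe G F u v d = ∃ λ k → (k ≤ d) × Walk (Adj G F) u v k

-- H is an f'-FT β-additive P-pairwise spanner of G:
-- for all F ⊆ E(G) with |F| ≤ f' and all (s,t) ∈ P,
-- dist_{H\F}(s,t) ≤ dist_{G\F}(s,t) + β  (with ∞ conventions; stated as
-- "every d bounding dist_{G\F} gives d + β bounding dist_{H\F}").
IsFTAdditivePairwiseSpanner : ∀ {n} → Graph n → Graph n → ℕ → ℕ →
                              (Fin n → Fin n → Set) → Set
IsFTAdditivePairwiseSpanner {n} G H f′ β P =
  (H ⊆G G) ×
  (∀ (F : List (Edge n)) → Unique F → (∀ {e} → e ∈ F → e ∈ edges G) →
     length F ≤ f′ →
     ∀ s t → P s t → ∀ d → DistLe G F s t d → DistLe H F s t (d + β))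

IsFTAdditiveSTSpanner : ∀ {n} → Graph n → Graph n → ℕ → ℕ →
                        Subset n → Subset n → Set
IsFTAdditiveSTSpanner G H f′ β S T =
  IsFTAdditivePairwiseSpanner G H f′ β (λ s t → (s ∈ₛ S) × (t ∈ₛ T))

-- The gadget B(d ∷ ds) is a spine path root, s₀, …, s_{d-1} with a tail from each s_j
-- to a copy of B(ds); the tails shrink by 2·∏ds + 1 per branch, so leaves under an
-- earlier branch lie deeper by at least 2·∏ds. The host graph joins every leaf of a
-- copies of B(ds) (tops in S) to every leaf of b copies of B(ds′) (tops in T). For
-- leaves l and m, fault at every level the spine edge just after the branch leading to
-- l (resp. m): at most 2f edges. A potential that changes by at most one along every
-- remaining edge other than lm shows that every walk between the two tops avoiding lm
-- is longer than the shortest one by 2. So a (2f)-FT +1 spanner keeps all a·b·∏ds·∏ds′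
-- cross edges; branching degrees about (n/(fa))^{1/(f+1)} make the gadgets fill the n
-- vertices and give the bound.
module Submission where

open import Data.Bool using (if_then_else_)
open import Data.Empty using (⊥-elim)
open import Data.Fin as Fin using (Fin; zero; suc; toℕ; fromℕ<; _↑ˡ_; _↑ʳ_; splitAt; combine; remQuot; cast; opposite)
open import Data.Fin.Properties
  using ( toℕ<n; toℕ-fromℕ<; toℕ-injective; toℕ-cast; toℕ-↑ˡ; toℕ-↑ʳ; toℕ-combine; opposite-prop
        ; splitAt-↑ˡ; splitAt-↑ʳ; splitAt⁻¹-↑ˡ; splitAt⁻¹-↑ʳ; remQuot-combine; combine-remQuot
        ; cast-involutive; opposite-involutive; injective⇒≤)
open import Data.Fin.Subset using (Subset; ∣_∣; ∁; inside; outside) renaming (_∈_ to _∈ₛ_; _∉_ to _∉ₛ_)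
open import Data.Fin.Subset.Properties using (∣∁p∣≡n∸∣p∣; x∉p⇒x∈∁p)
open import Data.List using (List; []; _∷_; _++_; map; length; replicate; filter; cartesianProduct; allFin; deduplicate; lookup)
open import Data.List.Membership.Propositional using (_∈_; _∉_)
open import Data.List.Membership.Propositional.Properties
  using (∈-++⁻; ∈-map⁻; ∈-map⁺; ∈-++⁺ˡ; ∈-++⁺ʳ; ∈-filter⁺; ∈-filter⁻; ∈-cartesianProduct⁺; ∈-allFin; ∈-deduplicate⁻; ∈-deduplicate⁺)
open import Data.List.Properties using (length-++; length-map; length-replicate; length-deduplicate)
open import Data.List.Relation.Unary.All as All using (All; []; _∷_)
open import Data.List.Relation.Unary.All.Properties using (all-filter) renaming (++⁺ to All-++⁺)
open import Data.List.Relation.Unary.Any as Any using (here; there)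
open import Data.List.Relation.Unary.Any.Properties using (lookup-index)
open import Data.List.Relation.Unary.Unique.DecPropositional.Properties using (deduplicate-!)
open import Data.List.Relation.Unary.Unique.Propositional using (Unique)
open import Data.List.Relation.Unary.Unique.Propositional.Properties using (filter⁺; cartesianProduct⁺; allFin⁺)
open import Data.Nat
open import Data.Nat.DivMod
open import Data.Nat.ListAction using (sum; product)
open import Data.Nat.ListAction.Properties using (sum-++; product-++)
open import Data.Nat.Properties
open import Data.Nat.Tactic.RingSolver using (solve-∀)
open import Data.Product using (Σ; _×_; _,_; proj₁; proj₂)
open import Data.Product.Properties using (≡-dec)
open import Data.Sum using (_⊎_; inj₁; inj₂; [_,_]; [_,_]′; map₁; swap)
open import Data.Unit using (⊤; tt)
open import Data.Vec.Base using ([]; _∷_; here; there)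
open import Defs
open import Function using (_∘_; id)
open import Relation.Binary.Definitions using (Tri; tri<; tri≈; tri>)
open import Relation.Binary.PropositionalEquality
  using (_≡_; _≢_; refl; sym; trans; cong; cong₂; subst; subst₂; module ≡-Reasoning)
open import Relation.Nullary using (Dec; yes; no; ¬_)
open import Relation.Nullary.Decidable using (_×-dec_; _⊎-dec_; ⌊_⌋)

infix 4 _≈₁_

_≈₁_ : ℕ → ℕ → Set
a ≈₁ b = a ≤ suc b × b ≤ suc a

≈₁-refl : ∀ a → a ≈₁ a
≈₁-refl a = n≤1+n a , n≤1+n a

≈₁-sym : ∀ {a b} → a ≈₁ b → b ≈₁ a
≈₁-sym (p , q) = q , p

n≈₁1+n : ∀ a → a ≈₁ suc a
n≈₁1+n a = m≤n⇒m≤1+n (n≤1+n a) , ≤-refl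

+-monoʳ-≈₁ : ∀ c {a b} → a ≈₁ b → c + a ≈₁ c + b
+-monoʳ-≈₁ c {a} {b} (p , q) =
  subst (c + a ≤_) (+-suc c b) (+-monoʳ-≤ c p) ,
  subst (c + b ≤_) (+-suc c a) (+-monoʳ-≤ c q)

⊓-monoˡ-≈₁ : ∀ c {a b} → a ≈₁ b → a ⊓ c ≈₁ b ⊓ c
⊓-monoˡ-≈₁ c (p , q) = ⊓-mono-≤ p (n≤1+n c) , ⊓-mono-≤ q (n≤1+n c)

∸-monoʳ-≈₁ : ∀ c {a b} → a ≈₁ b → c ∸ a ≈₁ c ∸ b
∸-monoʳ-≈₁ zero {a} {b} _ rewrite 0∸n≡0 a | 0∸n≡0 b = z≤n , z≤n
∸-monoʳ-≈₁ (suc c) {zero} {zero} _ = ≈₁-refl _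
∸-monoʳ-≈₁ (suc c) {zero} {suc zero} _ = ≤-refl , m≤n⇒m≤1+n (n≤1+n c)
∸-monoʳ-≈₁ (suc c) {zero} {suc (suc b)} (_ , s≤s ())
∸-monoʳ-≈₁ (suc c) {suc zero} {zero} _ = m≤n⇒m≤1+n (n≤1+n c) , ≤-refl
∸-monoʳ-≈₁ (suc c) {suc (suc a)} {zero} (s≤s () , _)
∸-monoʳ-≈₁ (suc c) {suc a} {suc b} (p , q) = ∸-monoʳ-≈₁ c (≤-pred p , ≤-pred q)

0≈₁1⊓n : ∀ c → 0 ≈₁ 1 ⊓ c
0≈₁1⊓n zero = z≤n , z≤n
0≈₁1⊓n (suc c) = z≤n , s≤s z≤n

infixr 5 _◅_ _◅◅_

data Chain {X : Set} (R : X → X → Set) : X → X → ℕ → Set where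
  ε : ∀ {x} → Chain R x x 0
  _◅_ : ∀ {x y z k} → R x y → Chain R y z k → Chain R x z (suc k)

_◅◅_ : ∀ {X : Set} {R : X → X → Set} {x y z m k} → Chain R x y m → Chain R y z k → Chain R x z (m + k)
ε ◅◅ c = c
(r ◅ c) ◅◅ c′ = r ◅ (c ◅◅ c′)

module _ {X : Set} {R : X → X → Set} where

  chain-reverse : ∀ {x y k} → Chain R x y k → Chain (λ a b → R b a) y x k
  chain-reverse ε = ε
  chain-reverse {k = suc k} (r ◅ c) = subst (Chain _ _ _) (+-comm k 1) (chain-reverse c ◅◅ (r ◅ ε))

  chain-map : ∀ {Y : Set} {S : Y → Y → Set} (g : X → Y) → (∀ {x y} → R x y → S (g x) (g y)) →
              ∀ {x y k} → Chain R x y k → Chain S (g x) (g y) k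
  chain-map g h ε = ε
  chain-map g h (r ◅ c) = h r ◅ chain-map g h c

walk-map : ∀ {n} {A B : Fin n → Fin n → Set} → (∀ {u v} → A u v → B u v) → ∀ {u v k} → Walk A u v k → Walk B u v k
walk-map g here = here
walk-map g (step a w) = step (g a) (walk-map g w)

walk-potential : ∀ {n} {A : Fin n → Fin n → Set} (Φ : Fin n → ℕ) → (∀ {u v} → A u v → Φ u ≈₁ Φ v) →
                 ∀ {u v k} → Walk A u v k → Φ v ≤ Φ u + k
walk-potential Φ lip here = m≤m+n _ 0
walk-potential Φ lip {u} {v} {suc k} (step {v = w} a c) = begin
  Φ v           ≤⟨ walk-potential Φ lip c ⟩
  Φ w + k       ≤⟨ +-monoˡ-≤ k (proj₂ (lip a)) ⟩
  suc (Φ u) + k ≡⟨ +-suc (Φ u) k ⟨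
  Φ u + suc k   ∎
  where open ≤-Reasoning

^-distribʳ-* : ∀ m n o → (m * n) ^ o ≡ m ^ o * n ^ o
^-distribʳ-* m n zero = refl
^-distribʳ-* m n (suc o) =
  trans (cong (m * n *_) (^-distribʳ-* m n o)) ([m*n]*[o*p]≡[m*o]*[n*p] m n (m ^ o) (n ^ o))

m^[n+1]≡m*m^n : ∀ m n → m ^ (n + 1) ≡ m * m ^ n
m^[n+1]≡m*m^n m n = cong (m ^_) (+-comm n 1)

m≤m^[1+n] : ∀ m n → 1 ≤ m → m ≤ m ^ suc n
m≤m^[1+n] m@(suc _) n _ = subst (_≤ m * m ^ n) (*-identityʳ m) (*-monoʳ-≤ m (m^n>0 m n))

m<[1+m/n]*n : ∀ m n .{{_ : NonZero n}} → m < suc (m / n) * n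
m<[1+m/n]*n m n = begin-strict
  m                 ≡⟨ m≡m%n+[m/n]*n m n ⟩
  m % n + m / n * n <⟨ +-monoˡ-< (m / n * n) (m%n<n m n) ⟩
  n + m / n * n     ∎
  where open ≤-Reasoning

scan-up : (P : ℕ → Set) → (∀ k → Dec (P k)) → ∀ r lo → P lo →
          Σ ℕ λ j → (lo ≤ j) × (j ≤ lo + r) × P j × ((j ≡ lo + r) ⊎ ¬ P (suc j))
scan-up P P? zero lo p = lo , ≤-refl , ≤-reflexive (sym (+-identityʳ lo)) , p , inj₁ (sym (+-identityʳ lo))
scan-up P P? (suc r) lo p with P? (suc lo)
... | no ¬p = lo , ≤-refl , m≤m+n lo (suc r) , p , inj₂ ¬p
... | yes q with scan-up P P? r (suc lo) q
... | j , lo<j , j≤ , pj , last =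
  j , <⇒≤ lo<j , ≤-trans j≤ (≤-reflexive (sym (+-suc lo r))) , pj , map₁ (λ e → trans e (sym (+-suc lo r))) last

integer-root : ∀ e X → 1 ≤ X → Σ ℕ λ d → (1 ≤ d) × (d ^ suc e ≤ X) × (X < suc d ^ suc e)
integer-root e X 1≤X with scan-up (λ d → d ^ suc e ≤ X) (λ d → d ^ suc e ≤? X) (X ∸ 1) 1 (subst (_≤ X) (sym (^-zeroˡ (suc e))) 1≤X)
... | d , 1≤d , _ , pd , inj₁ d≡X = d , 1≤d , pd , ≤-trans (s≤s (≤-reflexive X≡d)) (m≤m^[1+n] (suc d) e (s≤s z≤n))
  where
  X≡d : X ≡ d
  X≡d = trans (sym (m+[n∸m]≡n 1≤X)) (sym d≡X)
... | d , 1≤d , _ , pd , inj₂ ¬pd = d , 1≤d , pd , ≰⇒> ¬pd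

-- Tree gadgets

width : List ℕ → ℕ
width ds = 2 * product ds

tailLength : ℕ → List ℕ → ℕ → ℕ
tailLength d ds j = (d ∸ suc j) * suc (width ds) + 1

tailSlots : ℕ → List ℕ → ℕ
tailSlots d ds = suc (d * suc (width ds))

offset : ℕ → List ℕ → ℕ → ℕ
offset d ds j = j + 2 + tailLength d ds j

-- Tail positions at or beyond tailLength d ds j are isolated padding vertices, so that
-- all tails share the index type Fin (tailSlots d ds).
data Node : List ℕ → Set where
  point : Node []
  root  : ∀ {d ds} → Node (d ∷ ds)
  spine : ∀ {d ds} → Fin d → Node (d ∷ ds)
  tail  : ∀ {d ds} → Fin d → Fin (tailSlots d ds) → Node (d ∷ ds)
  copy  : ∀ {d ds} → Fin d → Node ds → Node (d ∷ ds)

top : ∀ ds → Node ds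
top [] = point
top (d ∷ ds) = root

data IsTop : ∀ {ds} → Node ds → Set where
  point-top : IsTop point
  root-top  : ∀ {d ds} → IsTop (root {d} {ds})

data IsLeaf : ∀ {ds} → Node ds → Set where
  point-leaf : IsLeaf point
  copy-leaf  : ∀ {d ds} (j : Fin d) {x : Node ds} → IsLeaf x → IsLeaf (copy j x)

data Link : ∀ {ds} → Node ds → Node ds → Set where
  root-spine  : ∀ {d ds} (j : Fin d) → toℕ j ≡ 0 → Link {d ∷ ds} root (spine j)
  spine-spine : ∀ {d ds} (j j′ : Fin d) → suc (toℕ j) ≡ toℕ j′ → Link {d ∷ ds} (spine j) (spine j′)
  spine-tail  : ∀ {d ds} (j : Fin d) (p : Fin (tailSlots d ds)) → toℕ p ≡ 0 → Link {d ∷ ds} (spine j) (tail j p)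
  tail-tail   : ∀ {d ds} (j : Fin d) (p q : Fin (tailSlots d ds)) → suc (toℕ p) ≡ toℕ q →
                toℕ q < tailLength d ds (toℕ j) → Link {d ∷ ds} (tail j p) (tail j q)
  tail-copy   : ∀ {d ds} (j : Fin d) (p : Fin (tailSlots d ds)) {x : Node ds} →
                suc (toℕ p) ≡ tailLength d ds (toℕ j) → IsTop x → Link {d ∷ ds} (tail j p) (copy j x)
  in-copy     : ∀ {d ds} (j : Fin d) {x y : Node ds} → Link x y → Link {d ∷ ds} (copy j x) (copy j y)

depth : ∀ {ds} → Node ds → ℕ
depth point = 0
depth root = 0
depth (spine j) = suc (toℕ j)
depth (tail j p) = suc (toℕ j) + suc (toℕ p)
depth {d ∷ ds} (copy j x) = offset d ds (toℕ j) + depth x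

depth-top : ∀ {ds} {x : Node ds} → IsTop x → depth x ≡ 0
depth-top point-top = refl
depth-top root-top = refl

depth-tail-end : ∀ d ds j p → suc p ≡ tailLength d ds j → suc (suc j + suc p) ≡ offset d ds j + 0
depth-tail-end d ds j p eq = begin
  suc (suc j + suc p)              ≡⟨ cong (λ z → suc (suc j + z)) eq ⟩
  suc (suc j + tailLength d ds j)  ≡⟨ rearrange j (tailLength d ds j) ⟩
  offset d ds j + 0                ∎
  where
  open ≡-Reasoning
  rearrange : ∀ j t → suc (suc j + t) ≡ j + 2 + t + 0
  rearrange = solve-∀

depth-≈₁ : ∀ {ds} {x y : Node ds} → Link x y → depth x ≈₁ depth y
depth-≈₁ (root-spine j eq) rewrite eq = n≈₁1+n 0
depth-≈₁ (spine-spine j j′ eq) rewrite sym eq = n≈₁1+n _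
depth-≈₁ (spine-tail j p eq) rewrite eq = subst (suc (toℕ j) ≈₁_) (+-comm 1 (suc (toℕ j))) (n≈₁1+n _)
depth-≈₁ (tail-tail j p q eq _) rewrite sym eq = +-monoʳ-≈₁ (suc (toℕ j)) (n≈₁1+n _)
depth-≈₁ {d ∷ ds} (tail-copy j p eq t) rewrite depth-top t =
  subst (suc (toℕ j) + suc (toℕ p) ≈₁_) (depth-tail-end d ds (toℕ j) (toℕ p) eq) (n≈₁1+n _)
depth-≈₁ {d ∷ ds} (in-copy j e) = +-monoʳ-≈₁ (offset d ds (toℕ j)) (depth-≈₁ e)

Address : List ℕ → Set
Address [] = ⊤
Address (d ∷ ds) = Fin d × Address ds

leaf : ∀ {ds} → Address ds → Node ds
leaf {[]} _ = point
leaf {d ∷ ds} (j , l) = copy j (leaf l)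

leaf-IsLeaf : ∀ {ds} (l : Address ds) → IsLeaf (leaf l)
leaf-IsLeaf {[]} _ = point-leaf
leaf-IsLeaf {d ∷ ds} (j , l) = copy-leaf j (leaf-IsLeaf l)

cap : ∀ {ds} → Address ds → ℕ
cap l = depth (leaf l) + 2

cappedIf : ∀ {a b : ℕ} → Dec (a ≤ b) → ℕ → ℕ → ℕ
cappedIf (yes _) v c = v ⊓ c
cappedIf (no _) v c = c

byBranch : ∀ {a b : ℕ} → Tri (a < b) (a ≡ b) (b < a) → ℕ → ℕ → ℕ → ℕ
byBranch (tri< _ _ _) before at c = before ⊓ c
byBranch (tri≈ _ _ _) before at c = at
byBranch (tri> _ _ _) before at c = c

-- Off cuts l, potential l changes by at most one along every link; it vanishes at the
-- top, equals depth (leaf l) at leaf l and cap l at every other leaf.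
potential : ∀ {ds} → Address ds → Node ds → ℕ
potential {[]} _ _ = 0
potential {d ∷ ds} l root = 0
potential {d ∷ ds} (i , l) (spine j) = cappedIf (toℕ j ≤? toℕ i) (suc (toℕ j)) (cap {d ∷ ds} (i , l))
potential {d ∷ ds} (i , l) (tail j p) = cappedIf (toℕ j ≤? toℕ i) (depth {d ∷ ds} (tail j p)) (cap {d ∷ ds} (i , l))
potential {d ∷ ds} (i , l) (copy j x) =
  byBranch (<-cmp (toℕ j) (toℕ i)) (offset d ds (toℕ j) + depth x) (offset d ds (toℕ j) + potential l x) (cap {d ∷ ds} (i , l))

potential-top : ∀ {ds} (l : Address ds) {x : Node ds} → IsTop x → potential l x ≡ 0
potential-top {[]} l point-top = refl
potential-top {d ∷ ds} l root-top = refl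

-- Cutting the spine right after branch i, at every level, separates the later
-- branches from the top.
spineCut : ∀ {d ds} → Fin d → List (Node (d ∷ ds) × Node (d ∷ ds))
spineCut {d} i with suc (toℕ i) <? d
... | yes p = (spine i , spine (fromℕ< p)) ∷ []
... | no _ = []

inCopy : ∀ {d ds} → Fin d → Node ds × Node ds → Node (d ∷ ds) × Node (d ∷ ds)
inCopy j (x , y) = copy j x , copy j y

cuts : ∀ {ds} → Address ds → List (Node ds × Node ds)
cuts {[]} _ = []
cuts {d ∷ ds} (i , l) = spineCut i ++ map (inCopy i) (cuts l)

∈-spineCut⁻ : ∀ {d ds} (i : Fin d) {x y : Node (d ∷ ds)} → (x , y) ∈ spineCut i →
  (x ≡ spine i) × (Σ (Fin d) λ k → (y ≡ spine k) × (toℕ k ≡ suc (toℕ i)))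
∈-spineCut⁻ {d} i m with suc (toℕ i) <? d
∈-spineCut⁻ i (here refl) | yes p = refl , fromℕ< p , refl , toℕ-fromℕ< p
∈-spineCut⁻ i () | no _

spineCut-∈ : ∀ {d ds} (i j j′ : Fin d) → toℕ j ≡ toℕ i → suc (toℕ j) ≡ toℕ j′ →
  _∈_ {A = Node (d ∷ ds) × Node (d ∷ ds)} (spine j , spine j′) (spineCut i)
spineCut-∈ {d} i j j′ j≡i j′≡1+j with suc (toℕ i) <? d
... | yes p = here (cong₂ _,_ (cong spine (toℕ-injective j≡i))
                 (cong spine (toℕ-injective (trans (sym j′≡1+j) (trans (cong suc j≡i) (sym (toℕ-fromℕ< p)))))))
... | no ¬p = ⊥-elim (¬p (subst (_< d) (trans (sym j′≡1+j) (cong suc j≡i)) (toℕ<n j′)))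

∈-cuts⁻ : ∀ {d ds} (i : Fin d) (l : Address ds) {x y : Node (d ∷ ds)} → (x , y) ∈ cuts {d ∷ ds} (i , l) →
  ((x ≡ spine i) × (Σ (Fin d) λ k → (y ≡ spine k) × (toℕ k ≡ suc (toℕ i)))) ⊎
  (Σ (Node ds) λ x′ → Σ (Node ds) λ y′ → (x ≡ copy i x′) × (y ≡ copy i y′) × ((x′ , y′) ∈ cuts l))
∈-cuts⁻ i l m with ∈-++⁻ (spineCut i) m
... | inj₁ m₁ = inj₁ (∈-spineCut⁻ i m₁)
... | inj₂ m₂ with ∈-map⁻ (inCopy i) m₂
... | (x′ , y′) , m₃ , refl = inj₂ (x′ , y′ , refl , refl , m₃)

copy-∈-cuts : ∀ {d ds} (i j : Fin d) (l : Address ds) {x y : Node ds} → toℕ j ≡ toℕ i → (x , y) ∈ cuts l →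
  (copy j x , copy j y) ∈ cuts {d ∷ ds} (i , l)
copy-∈-cuts i j l j≡i m rewrite toℕ-injective j≡i = ∈-++⁺ʳ (spineCut i) (∈-map⁺ (inCopy i) m)

depth-tail≤offset : ∀ d ds j → suc (suc j + tailLength d ds j) ≤ offset d ds j
depth-tail≤offset d ds j = ≤-reflexive (rearrange j (tailLength d ds j))
  where
  rearrange : ∀ j t → suc (suc j + t) ≡ j + 2 + t
  rearrange = solve-∀

tail-end≤cap : ∀ {d ds} (i j : Fin d) (l : Address ds) (p : Fin (tailSlots d ds)) →
               suc (toℕ p) ≡ tailLength d ds (toℕ j) → toℕ j ≡ toℕ i → depth {d ∷ ds} (tail j p) ≤ cap {d ∷ ds} (i , l)
tail-end≤cap {d} {ds} i j l p 1+p≡len j≡i = begin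
  suc (toℕ j) + suc (toℕ p)                    ≡⟨ cong (suc (toℕ j) +_) 1+p≡len ⟩
  suc (toℕ j) + tailLength d ds (toℕ j)        ≤⟨ n≤1+n _ ⟩
  suc (suc (toℕ j) + tailLength d ds (toℕ j))  ≤⟨ depth-tail≤offset d ds (toℕ j) ⟩
  offset d ds (toℕ j)                          ≡⟨ cong (offset d ds) j≡i ⟩
  offset d ds (toℕ i)                          ≤⟨ m≤m+n _ _ ⟩
  offset d ds (toℕ i) + depth (leaf l)         ≤⟨ m≤m+n _ _ ⟩
  cap {d ∷ ds} (i , l)                         ∎
  where open ≤-Reasoning

potential-≈₁ : ∀ {ds} (l : Address ds) {x y : Node ds} → Link x y → (x , y) ∉ cuts l →
               potential l x ≈₁ potential l y
potential-≈₁ {d ∷ ds} (i , l) (root-spine j j≡0) _ with toℕ j ≤? toℕ i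
... | yes _ rewrite j≡0 = 0≈₁1⊓n _
... | no j≰i = ⊥-elim (j≰i (subst (_≤ toℕ i) (sym j≡0) z≤n))
potential-≈₁ {d ∷ ds} (i , l) (spine-spine j j′ j′≡1+j) uncut with toℕ j ≤? toℕ i | toℕ j′ ≤? toℕ i
... | yes _ | yes _ = ⊓-monoˡ-≈₁ _ (subst (λ z → suc (toℕ j) ≈₁ suc z) j′≡1+j (n≈₁1+n _))
... | yes j≤i | no j′≰i =
  ⊥-elim (uncut (∈-++⁺ˡ (spineCut-∈ i j j′ (≤-antisym j≤i (≤-pred (subst (toℕ i <_) (sym j′≡1+j) (≰⇒> j′≰i)))) j′≡1+j)))
... | no j≰i | yes j′≤i = ⊥-elim (j≰i (≤-trans (n≤1+n _) (subst (_≤ toℕ i) (sym j′≡1+j) j′≤i)))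
... | no _ | no _ = ≈₁-refl _
potential-≈₁ {d ∷ ds} (i , l) (spine-tail j p p≡0) _ with toℕ j ≤? toℕ i
... | yes _ = ⊓-monoˡ-≈₁ _ (subst (λ z → suc (toℕ j) ≈₁ suc (toℕ j) + suc z) (sym p≡0)
                 (subst (suc (toℕ j) ≈₁_) (+-comm 1 (suc (toℕ j))) (n≈₁1+n _)))
... | no _ = ≈₁-refl _
potential-≈₁ {d ∷ ds} (i , l) e@(tail-tail j p q _ _) _ with toℕ j ≤? toℕ i
... | yes _ = ⊓-monoˡ-≈₁ _ (depth-≈₁ e)
... | no _ = ≈₁-refl _
potential-≈₁ {d ∷ ds} (i , l) e@(tail-copy j p 1+p≡len t) _ with <-cmp (toℕ j) (toℕ i) | toℕ j ≤? toℕ i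
... | tri< _ _ _ | yes _ = ⊓-monoˡ-≈₁ _ (depth-≈₁ e)
... | tri< j<i _ _ | no j≰i = ⊥-elim (j≰i (<⇒≤ j<i))
... | tri≈ _ j≡i _ | no j≰i = ⊥-elim (j≰i (≤-reflexive j≡i))
... | tri> _ _ i<j | yes j≤i = ⊥-elim (<⇒≱ i<j j≤i)
... | tri> _ _ _ | no _ = ≈₁-refl _
... | tri≈ _ j≡i _ | yes _ =
  subst₂ _≈₁_ (sym (m≤n⇒m⊓n≡m (tail-end≤cap i j l p 1+p≡len j≡i))) (cong (offset d ds (toℕ j) +_) (sym (potential-top l t)))
    (subst (suc (toℕ j) + suc (toℕ p) ≈₁_) (depth-tail-end d ds (toℕ j) (toℕ p) 1+p≡len) (n≈₁1+n _))
potential-≈₁ {d ∷ ds} (i , l) (in-copy j e) uncut with <-cmp (toℕ j) (toℕ i)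
... | tri< _ _ _ = ⊓-monoˡ-≈₁ _ (+-monoʳ-≈₁ (offset d ds (toℕ j)) (depth-≈₁ e))
... | tri≈ _ j≡i _ = +-monoʳ-≈₁ (offset d ds (toℕ j)) (potential-≈₁ l e (λ m → uncut (copy-∈-cuts i j l j≡i m)))
... | tri> _ _ _ = ≈₁-refl _

minDepth : List ℕ → ℕ
minDepth [] = 0
minDepth (d ∷ ds) = d + 2 + minDepth ds

offset≡ : ∀ d ds j → j < d → offset d ds j ≡ (d ∸ suc j) * width ds + (d + 2)
offset≡ d ds j j<d = begin
  j + 2 + ((d ∸ suc j) * suc (width ds) + 1)         ≡⟨ rearrange j (d ∸ suc j) (width ds) ⟩
  (d ∸ suc j) * width ds + (suc j + (d ∸ suc j) + 2) ≡⟨ cong (λ z → (d ∸ suc j) * width ds + (z + 2)) (m+[n∸m]≡n j<d) ⟩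
  (d ∸ suc j) * width ds + (d + 2)                   ∎
  where
  open ≡-Reasoning
  rearrange : ∀ j k W → j + 2 + (k * suc W + 1) ≡ k * W + (suc j + k + 2)
  rearrange = solve-∀

minDepth≤depth : ∀ {ds} {x : Node ds} → IsLeaf x → minDepth ds ≤ depth x
minDepth≤depth point-leaf = z≤n
minDepth≤depth {d ∷ ds} (copy-leaf j x-leaf) =
  +-mono-≤ (subst (d + 2 ≤_) (sym (offset≡ d ds (toℕ j) (toℕ<n j))) (m≤n+m (d + 2) ((d ∸ suc (toℕ j)) * width ds))) (minDepth≤depth x-leaf)

cap≤minDepth+width : ∀ {ds} (l : Address ds) → cap l ≤ minDepth ds + width ds
cap≤minDepth+width {[]} l = ≤-refl
cap≤minDepth+width {d ∷ ds} (i , l) = begin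
  offset d ds (toℕ i) + depth (leaf l) + 2     ≡⟨ +-assoc (offset d ds (toℕ i)) (depth (leaf l)) 2 ⟩
  offset d ds (toℕ i) + cap l                  ≤⟨ +-monoʳ-≤ (offset d ds (toℕ i)) (cap≤minDepth+width l) ⟩
  offset d ds (toℕ i) + (minDepth ds + W)      ≡⟨ cong (_+ (minDepth ds + W)) (offset≡ d ds (toℕ i) (toℕ<n i)) ⟩
  k * W + (d + 2) + (minDepth ds + W)          ≡⟨ rearrange (k * W) (d + 2) (minDepth ds) W ⟩
  (suc k * W) + (d + 2 + minDepth ds)          ≤⟨ +-monoˡ-≤ (d + 2 + minDepth ds) (*-monoˡ-≤ W 1+k≤d) ⟩
  d * W + (d + 2 + minDepth ds)                ≡⟨ rearrange′ d (product ds) (d + 2 + minDepth ds) ⟩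
  minDepth (d ∷ ds) + width (d ∷ ds)           ∎
  where
  open ≤-Reasoning
  k = d ∸ suc (toℕ i)
  W = width ds
  1+k≤d : suc k ≤ d
  1+k≤d = ≤-trans (≤-reflexive (sym (+-∸-assoc 1 (toℕ<n i)))) (m∸n≤m d (toℕ i))
  rearrange : ∀ a b c e → a + b + (c + e) ≡ (e + a) + (b + c)
  rearrange = solve-∀
  rearrange′ : ∀ d P m → d * (2 * P) + m ≡ m + 2 * (d * P)
  rearrange′ = solve-∀

offset-gap : ∀ d ds j i → j < i → i < d → offset d ds i + width ds ≤ offset d ds j
offset-gap d ds j i j<i i<d = begin
  offset d ds i + W                   ≡⟨ cong (_+ W) (offset≡ d ds i i<d) ⟩
  (d ∸ suc i) * W + (d + 2) + W       ≡⟨ rearrange ((d ∸ suc i) * W) (d + 2) W ⟩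
  suc (d ∸ suc i) * W + (d + 2)       ≤⟨ +-monoˡ-≤ (d + 2) (*-monoˡ-≤ W steps) ⟩
  (d ∸ suc j) * W + (d + 2)           ≡⟨ offset≡ d ds j (<-trans j<i i<d) ⟨
  offset d ds j                       ∎
  where
  open ≤-Reasoning
  W = width ds
  rearrange : ∀ a b c → a + b + c ≡ (c + a) + b
  rearrange = solve-∀
  steps : suc (d ∸ suc i) ≤ d ∸ suc j
  steps = begin
    suc (d ∸ suc i) ≡⟨ +-∸-assoc 1 i<d ⟨
    d ∸ i           ≤⟨ ∸-monoʳ-≤ d j<i ⟩
    d ∸ suc j       ∎

cap≤depth-later-branch : ∀ {d ds} (i j : Fin d) (l : Address ds) {x : Node ds} → toℕ j < toℕ i → IsLeaf x →
                         cap {d ∷ ds} (i , l) ≤ offset d ds (toℕ j) + depth x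
cap≤depth-later-branch {d} {ds} i j l {x} j<i x-leaf = begin
  offset d ds (toℕ i) + depth (leaf l) + 2        ≡⟨ +-assoc (offset d ds (toℕ i)) (depth (leaf l)) 2 ⟩
  offset d ds (toℕ i) + cap l                     ≤⟨ +-monoʳ-≤ (offset d ds (toℕ i)) (cap≤minDepth+width l) ⟩
  offset d ds (toℕ i) + (minDepth ds + width ds)  ≡⟨ cong (offset d ds (toℕ i) +_) (+-comm (minDepth ds) (width ds)) ⟩
  offset d ds (toℕ i) + (width ds + minDepth ds)  ≡⟨ +-assoc (offset d ds (toℕ i)) (width ds) (minDepth ds) ⟨
  offset d ds (toℕ i) + width ds + minDepth ds    ≤⟨ +-mono-≤ (offset-gap d ds (toℕ j) (toℕ i) j<i (toℕ<n i)) (minDepth≤depth x-leaf) ⟩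
  offset d ds (toℕ j) + depth x                   ∎
  where open ≤-Reasoning

potential-leaf : ∀ {ds} (l : Address ds) → potential l (leaf l) ≡ depth (leaf l)
potential-leaf {[]} l = refl
potential-leaf {d ∷ ds} (i , l) with <-cmp (toℕ i) (toℕ i)
... | tri< i<i _ _ = ⊥-elim (<-irrefl refl i<i)
... | tri≈ _ _ _ = cong (offset d ds (toℕ i) +_) (potential-leaf l)
... | tri> _ _ i<i = ⊥-elim (<-irrefl refl i<i)

potential-IsLeaf : ∀ {ds} (l : Address ds) {x : Node ds} → IsLeaf x → (x ≡ leaf l) ⊎ (potential l x ≡ cap l)
potential-IsLeaf {[]} l point-leaf = inj₁ refl
potential-IsLeaf {d ∷ ds} (i , l) (copy-leaf j x-leaf) with <-cmp (toℕ j) (toℕ i)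
... | tri< j<i _ _ = inj₂ (m≥n⇒m⊓n≡n (cap≤depth-later-branch i j l j<i x-leaf))
... | tri> _ _ _ = inj₂ refl
... | tri≈ _ j≡i _ with potential-IsLeaf l x-leaf
...   | inj₁ x≡l = inj₁ (cong₂ copy (toℕ-injective j≡i) x≡l)
...   | inj₂ x-capped = inj₂ (begin
  offset d ds (toℕ j) + potential l _      ≡⟨ cong (offset d ds (toℕ j) +_) x-capped ⟩
  offset d ds (toℕ j) + cap l              ≡⟨ +-assoc (offset d ds (toℕ j)) (depth (leaf l)) 2 ⟨
  offset d ds (toℕ j) + depth (leaf l) + 2 ≡⟨ cong (λ z → offset d ds z + depth (leaf l) + 2) j≡i ⟩
  cap {d ∷ ds} (i , l)                     ∎)
  where open ≡-Reasoning

Uncut : ∀ {ds} → Address ds → Node ds → Node ds → Set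
Uncut l x y = Link x y × ((x , y) ∉ cuts l) × ((y , x) ∉ cuts l)

Uncut-copy : ∀ {d ds} (i : Fin d) (l : Address ds) {x y : Node ds} → Uncut l x y →
             Uncut {d ∷ ds} (i , l) (copy i x) (copy i y)
Uncut-copy i l (e , ∉xy , ∉yx) = in-copy i e , lift ∉xy , lift ∉yx
  where
  lift : ∀ {a b} → (a , b) ∉ cuts l → (copy i a , copy i b) ∉ cuts {_ ∷ _} (i , l)
  lift ∉ab m with ∈-cuts⁻ i l m
  ... | inj₁ (() , _)
  ... | inj₂ (_ , _ , refl , refl , m′) = ∉ab m′

spine-injective : ∀ {d ds} {a b : Fin d} → spine {d} {ds} a ≡ spine b → a ≡ b
spine-injective refl = refl

top-IsTop : ∀ ds → IsTop (top ds)
top-IsTop [] = point-top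
top-IsTop (d ∷ ds) = root-top

module _ {d ds} (i : Fin d) (l : Address ds) where

  private
    Cuts = cuts {d ∷ ds} (i , l)

  root-∉-cuts : ∀ {y} → (root , y) ∉ Cuts
  root-∉-cuts m with ∈-cuts⁻ i l m
  ... | inj₁ (() , _)
  ... | inj₂ (_ , _ , () , _)

  ∉-cuts-root : ∀ {x} → (x , root) ∉ Cuts
  ∉-cuts-root m with ∈-cuts⁻ i l m
  ... | inj₁ (_ , _ , () , _)
  ... | inj₂ (_ , _ , _ , () , _)

  tail-∉-cuts : ∀ {j p y} → (tail j p , y) ∉ Cuts
  tail-∉-cuts m with ∈-cuts⁻ i l m
  ... | inj₁ (() , _)
  ... | inj₂ (_ , _ , () , _)

  ∉-cuts-tail : ∀ {x j p} → (x , tail j p) ∉ Cuts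
  ∉-cuts-tail m with ∈-cuts⁻ i l m
  ... | inj₁ (_ , _ , () , _)
  ... | inj₂ (_ , _ , _ , () , _)

  spine-chain : ∀ b (j j′ : Fin d) → toℕ j + b ≡ toℕ j′ → toℕ j′ ≤ toℕ i → Chain (Uncut (i , l)) (spine j) (spine j′) b
  spine-chain zero j j′ j≡j′ _ rewrite toℕ-injective (trans (sym (+-identityʳ (toℕ j))) j≡j′) = ε
  spine-chain (suc b) j j′ eq j′≤i =
    (spine-spine j next (sym (toℕ-fromℕ< 1+j<d)) , ∉forward , ∉backward)
    ◅ spine-chain b next j′ (trans (cong (_+ b) (toℕ-fromℕ< 1+j<d)) (trans (sym (+-suc (toℕ j) b)) eq)) j′≤i
    where
    j<j′ : toℕ j < toℕ j′
    j<j′ = subst (toℕ j <_) eq (m<m+n (toℕ j) (s≤s z≤n))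
    1+j<d : suc (toℕ j) < d
    1+j<d = ≤-<-trans j<j′ (toℕ<n j′)
    next = fromℕ< 1+j<d
    ∉forward : (spine j , spine next) ∉ Cuts
    ∉forward m with ∈-cuts⁻ i l m
    ... | inj₁ (e , _) = <-irrefl (cong toℕ (spine-injective e)) (<-≤-trans j<j′ j′≤i)
    ... | inj₂ (_ , _ , () , _)
    ∉backward : (spine next , spine j) ∉ Cuts
    ∉backward m with ∈-cuts⁻ i l m
    ... | inj₁ (_ , k , e₁ , e₂) = <-irrefl (trans (cong toℕ (spine-injective e₁)) e₂) (<-≤-trans j<j′ (≤-trans j′≤i (n≤1+n _)))
    ... | inj₂ (_ , _ , () , _)

  tailLength≤tailSlots : tailLength d ds (toℕ i) ≤ tailSlots d ds
  tailLength≤tailSlots = subst (_≤ tailSlots d ds) (+-comm 1 _) (s≤s (*-monoˡ-≤ (suc (width ds)) (m∸n≤m d (suc (toℕ i)))))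

  tail-chain : ∀ b (p q : Fin (tailSlots d ds)) → toℕ p + b ≡ toℕ q → toℕ q < tailLength d ds (toℕ i) →
               Chain (Uncut (i , l)) (tail i p) (tail i q) b
  tail-chain zero p q p≡q _ rewrite toℕ-injective (trans (sym (+-identityʳ (toℕ p))) p≡q) = ε
  tail-chain (suc b) p q eq q<len =
    (tail-tail i p next (sym (toℕ-fromℕ< 1+p<slots)) (≤-<-trans next≤q q<len) , tail-∉-cuts , tail-∉-cuts)
    ◅ tail-chain b next q (trans (cong (_+ b) (toℕ-fromℕ< 1+p<slots)) (trans (sym (+-suc (toℕ p) b)) eq)) q<len
    where
    p<q : toℕ p < toℕ q
    p<q = subst (toℕ p <_) eq (m<m+n (toℕ p) (s≤s z≤n))
    1+p<slots : suc (toℕ p) < tailSlots d ds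
    1+p<slots = <-≤-trans (≤-<-trans p<q q<len) tailLength≤tailSlots
    next = fromℕ< 1+p<slots
    next≤q : toℕ next ≤ toℕ q
    next≤q = subst (_≤ toℕ q) (sym (toℕ-fromℕ< 1+p<slots)) p<q

top-to-leaf : ∀ {ds} (l : Address ds) → Chain (Uncut l) (top ds) (leaf l) (depth (leaf l))
top-to-leaf {[]} l = ε
top-to-leaf {zero ∷ ds} (() , l)
top-to-leaf {suc d ∷ ds} (i , l) =
  subst (Chain _ _ _) length-≡
    ((root-spine zero refl , root-∉-cuts i l , ∉-cuts-root i l)
    ◅ spine-chain i l (toℕ i) zero i refl ≤-refl
    ◅◅ (spine-tail i zero refl , ∉-cuts-tail i l , tail-∉-cuts i l)
    ◅ tail-chain i l t zero end (sym toℕ-end) (subst (_< tailLength D ds (toℕ i)) (sym toℕ-end) (subst (t <_) (+-comm 1 t) ≤-refl))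
    ◅◅ (tail-copy i end (trans (cong suc toℕ-end) (+-comm 1 t)) (top-IsTop ds) , tail-∉-cuts i l , ∉-cuts-tail i l)
    ◅ chain-map (copy i) (Uncut-copy i l) (top-to-leaf l))
  where
  D = suc d
  t = (D ∸ suc (toℕ i)) * suc (width ds)
  t<slots : t < tailSlots D ds
  t<slots = subst (_≤ tailSlots D ds) (+-comm t 1) (tailLength≤tailSlots i l)
  end = fromℕ< t<slots
  toℕ-end : toℕ end ≡ t
  toℕ-end = toℕ-fromℕ< t<slots
  length-≡ : suc (toℕ i + suc (t + suc (depth (leaf l)))) ≡ offset D ds (toℕ i) + depth (leaf l)
  length-≡ = rearrange (toℕ i) t (depth (leaf l))
    where
    rearrange : ∀ i t A → suc (i + suc (t + suc A)) ≡ i + 2 + (t + 1) + A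
    rearrange = solve-∀

length-cuts : ∀ {ds} (l : Address ds) → length (cuts l) ≤ length ds
length-cuts {[]} l = z≤n
length-cuts {d ∷ ds} (i , l) = begin
  length (spineCut {d} {ds} i ++ map (inCopy i) (cuts l))        ≡⟨ length-++ (spineCut {d} {ds} i) ⟩
  length (spineCut {d} {ds} i) + length (map (inCopy i) (cuts l)) ≡⟨ cong (length (spineCut {d} {ds} i) +_) (length-map (inCopy i) (cuts l)) ⟩
  length (spineCut {d} {ds} i) + length (cuts l)                  ≤⟨ +-mono-≤ length-spineCut (length-cuts l) ⟩
  suc (length ds)                                                 ∎
  where
  open ≤-Reasoning
  length-spineCut : length (spineCut {d} {ds} i) ≤ 1
  length-spineCut with suc (toℕ i) <? d
  ... | yes _ = ≤-refl
  ... | no _ = z≤n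

cuts⊆Link : ∀ {ds} (l : Address ds) {x y : Node ds} → (x , y) ∈ cuts l → Link x y
cuts⊆Link {[]} l ()
cuts⊆Link {d ∷ ds} (i , l) m with ∈-cuts⁻ i l m
... | inj₁ (refl , k , refl , k≡1+i) = spine-spine i k (sym k≡1+i)
... | inj₂ (_ , _ , refl , refl , m′) = in-copy i (cuts⊆Link l m′)

Link-irrefl : ∀ {ds} {x : Node ds} → ¬ Link x x
Link-irrefl (spine-spine j .j eq) = <-irrefl (sym eq) (n<1+n _)
Link-irrefl (tail-tail j p .p eq _) = <-irrefl (sym eq) (n<1+n _)
Link-irrefl (in-copy j e) = Link-irrefl e

IsTop? : ∀ {ds} (x : Node ds) → Dec (IsTop x)
IsTop? point = yes point-top
IsTop? root = yes root-top
IsTop? (spine _) = no λ ()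
IsTop? (tail _ _) = no λ ()
IsTop? (copy _ _) = no λ ()

IsLeaf? : ∀ {ds} (x : Node ds) → Dec (IsLeaf x)
IsLeaf? point = yes point-leaf
IsLeaf? root = no λ ()
IsLeaf? (spine _) = no λ ()
IsLeaf? (tail _ _) = no λ ()
IsLeaf? (copy j x) with IsLeaf? x
... | yes x-leaf = yes (copy-leaf j x-leaf)
... | no ¬x-leaf = no λ { (copy-leaf _ x-leaf) → ¬x-leaf x-leaf }

Link? : ∀ {ds} (x y : Node ds) → Dec (Link x y)
Link? point point = no λ ()
Link? root root = no λ ()
Link? root (spine j) with toℕ j ≟ 0
... | yes e = yes (root-spine j e)
... | no ¬e = no λ { (root-spine _ e) → ¬e e }
Link? root (tail _ _) = no λ ()
Link? root (copy _ _) = no λ ()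
Link? (spine _) root = no λ ()
Link? (spine j) (spine j′) with suc (toℕ j) ≟ toℕ j′
... | yes e = yes (spine-spine j j′ e)
... | no ¬e = no λ { (spine-spine _ _ e) → ¬e e }
Link? (spine j) (tail j′ p) with j Fin.≟ j′ | toℕ p ≟ 0
... | yes refl | yes e = yes (spine-tail j p e)
... | no j≢j′ | _ = no λ { (spine-tail _ _ _) → j≢j′ refl }
... | yes refl | no ¬e = no λ { (spine-tail _ _ e) → ¬e e }
Link? (spine _) (copy _ _) = no λ ()
Link? (tail _ _) root = no λ ()
Link? (tail _ _) (spine _) = no λ ()
Link? {d ∷ ds} (tail j p) (tail j′ q) with j Fin.≟ j′ | suc (toℕ p) ≟ toℕ q | toℕ q <? tailLength d ds (toℕ j)
... | yes refl | yes e | yes q<len = yes (tail-tail j p q e q<len)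
... | no j≢j′ | _ | _ = no λ { (tail-tail _ _ _ _ _) → j≢j′ refl }
... | yes refl | no ¬e | _ = no λ { (tail-tail _ _ _ e _) → ¬e e }
... | yes refl | yes _ | no q≮len = no λ { (tail-tail _ _ _ _ q<len) → q≮len q<len }
Link? {d ∷ ds} (tail j p) (copy j′ x) with j Fin.≟ j′ | suc (toℕ p) ≟ tailLength d ds (toℕ j) | IsTop? x
... | yes refl | yes e | yes t = yes (tail-copy j p e t)
... | no j≢j′ | _ | _ = no λ { (tail-copy _ _ _ _) → j≢j′ refl }
... | yes refl | no ¬e | _ = no λ { (tail-copy _ _ e _) → ¬e e }
... | yes refl | yes _ | no ¬t = no λ { (tail-copy _ _ _ t) → ¬t t }
Link? (copy _ _) root = no λ ()
Link? (copy _ _) (spine _) = no λ ()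
Link? (copy _ _) (tail _ _) = no λ ()
Link? (copy j x) (copy j′ y) with j Fin.≟ j′ | Link? x y
... | yes refl | yes e = yes (in-copy j e)
... | no j≢j′ | _ = no λ { (in-copy _ _) → j≢j′ refl }
... | yes refl | no ¬e = no λ { (in-copy _ e) → ¬e e }

size : List ℕ → ℕ
size [] = 1
size (d ∷ ds) = suc (d + (d * tailSlots d ds + d * size ds))

encode : ∀ {ds} → Node ds → Fin (size ds)
encode point = zero
encode root = zero
encode {d ∷ ds} (spine j) = suc (j ↑ˡ (d * tailSlots d ds + d * size ds))
encode {d ∷ ds} (tail j p) = suc (d ↑ʳ (combine j p ↑ˡ (d * size ds)))
encode {d ∷ ds} (copy j x) = suc (d ↑ʳ ((d * tailSlots d ds) ↑ʳ combine j (encode x)))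

mutual
  decode : ∀ {ds} → Fin (size ds) → Node ds
  decode {[]} _ = point
  decode {d ∷ ds} zero = root
  decode {d ∷ ds} (suc u) = decode-spine-or-rest (splitAt d u)

  decode-spine-or-rest : ∀ {d ds} → Fin d ⊎ Fin (d * tailSlots d ds + d * size ds) → Node (d ∷ ds)
  decode-spine-or-rest (inj₁ j) = spine j
  decode-spine-or-rest {d} {ds} (inj₂ w) = decode-tail-or-copy (splitAt (d * tailSlots d ds) w)

  decode-tail-or-copy : ∀ {d ds} → Fin (d * tailSlots d ds) ⊎ Fin (d * size ds) → Node (d ∷ ds)
  decode-tail-or-copy {d} {ds} (inj₁ q) = tail (proj₁ (remQuot (tailSlots d ds) q)) (proj₂ (remQuot {d} (tailSlots d ds) q))
  decode-tail-or-copy {d} {ds} (inj₂ q) = copy (proj₁ (remQuot (size ds) q)) (decode (proj₂ (remQuot {d} (size ds) q)))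

decode-encode : ∀ {ds} (x : Node ds) → decode (encode x) ≡ x
decode-encode point = refl
decode-encode root = refl
decode-encode {d ∷ ds} (spine j) rewrite splitAt-↑ˡ d j (d * tailSlots d ds + d * size ds) = refl
decode-encode {d ∷ ds} (tail j p)
  rewrite splitAt-↑ʳ d (d * tailSlots d ds + d * size ds) (combine j p ↑ˡ (d * size ds))
        | splitAt-↑ˡ (d * tailSlots d ds) (combine j p) (d * size ds)
        = cong (λ r → tail (proj₁ r) (proj₂ r)) (remQuot-combine {d} {tailSlots d ds} j p)
decode-encode {d ∷ ds} (copy j x)
  rewrite splitAt-↑ʳ d (d * tailSlots d ds + d * size ds) ((d * tailSlots d ds) ↑ʳ combine j (encode x))
        | splitAt-↑ʳ (d * tailSlots d ds) (d * size ds) (combine j (encode x))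
        = trans (cong (λ r → copy (proj₁ r) (decode (proj₂ r))) (remQuot-combine {d} {size ds} j (encode x)))
                (cong (copy j) (decode-encode x))

encode-decode : ∀ {ds} (u : Fin (size ds)) → encode (decode {ds} u) ≡ u
encode-decode {[]} zero = refl
encode-decode {d ∷ ds} zero = refl
encode-decode {d ∷ ds} (suc u) with splitAt d u in eq
... | inj₁ j = cong suc (splitAt⁻¹-↑ˡ eq)
... | inj₂ w with splitAt (d * tailSlots d ds) w in eq₂
...   | inj₁ q = cong suc (trans (cong (d ↑ʳ_) (trans (cong (_↑ˡ (d * size ds)) (combine-remQuot {d} (tailSlots d ds) q))
                                                        (splitAt⁻¹-↑ˡ eq₂)))
                                 (splitAt⁻¹-↑ʳ eq))
...   | inj₂ q = cong suc (trans (cong (d ↑ʳ_) (trans (cong ((d * tailSlots d ds) ↑ʳ_) combine-q) (splitAt⁻¹-↑ʳ eq₂)))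
                                 (splitAt⁻¹-↑ʳ eq))
  where
  jv = remQuot {d} (size ds) q
  combine-q : combine (proj₁ jv) (encode (decode {ds} (proj₂ jv))) ≡ q
  combine-q = trans (cong (combine (proj₁ jv)) (encode-decode (proj₂ jv))) (combine-remQuot {d} (size ds) q)

toℕ-encode-top : ∀ ds → toℕ (encode (top ds)) ≡ 0
toℕ-encode-top [] = refl
toℕ-encode-top (d ∷ ds) = refl

address : ∀ {ds} → Fin (product ds) → Address ds
address {[]} _ = tt
address {d ∷ ds} u = proj₁ (remQuot {d} (product ds) u) , address (proj₂ (remQuot {d} (product ds) u))

address-injective : ∀ {ds} (u v : Fin (product ds)) → address {ds} u ≡ address v → u ≡ v
address-injective {[]} zero zero _ = refl
address-injective {d ∷ ds} u v eq =
  trans (sym (combine-remQuot {d} (product ds) u))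
    (trans (cong₂ combine (cong proj₁ eq) (address-injective _ _ (cong proj₂ eq))) (combine-remQuot {d} (product ds) v))

leaf-injective : ∀ {ds} (l l′ : Address ds) → leaf l ≡ leaf l′ → l ≡ l′
leaf-injective {[]} tt tt _ = refl
leaf-injective {d ∷ ds} (j , l) (j′ , l′) eq with copy-injective eq
  where
  copy-injective : ∀ {a b : Fin d} {x y : Node ds} → copy {d} {ds} a x ≡ copy b y → (a ≡ b) × (x ≡ y)
  copy-injective refl = refl , refl
... | refl , leaf≡ = cong (j ,_) (leaf-injective l l′ leaf≡)

product-positive : ∀ ds → All (1 ≤_) ds → 1 ≤ product ds
product-positive [] _ = s≤s z≤n
product-positive (d ∷ ds) (1≤d ∷ ps) = *-mono-≤ 1≤d (product-positive ds ps)

size≤ : ∀ ds → All (1 ≤_) ds → size ds ≤ product ds * (1 + 6 * sum ds)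
size≤ [] _ = s≤s z≤n
size≤ (d ∷ ds) (1≤d ∷ ps) = begin
  suc (d + (d * tailSlots d ds + d * size ds)) ≡⟨ cong suc (+-assoc d (d * tailSlots d ds) (d * size ds)) ⟨
  suc (d + d * tailSlots d ds) + d * size ds   ≤⟨ +-mono-≤ (spine-and-tails 1≤d (product-positive ds ps)) (*-monoʳ-≤ d (size≤ ds ps)) ⟩
  6 * d * d * P + d * (P * (1 + 6 * S))        ≡⟨ rearrange d P S ⟩
  d * P * (1 + 6 * (d + S))                    ∎
  where
  open ≤-Reasoning
  P = product ds
  S = sum ds
  rearrange : ∀ d P S → 6 * d * d * P + d * (P * (1 + 6 * S)) ≡ d * P * (1 + 6 * (d + S))
  rearrange = solve-∀
  spine-and-tails : ∀ {d P} → 1 ≤ d → 1 ≤ P → suc (d + d * suc (d * suc (2 * P))) ≤ 6 * d * d * P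
  spine-and-tails {suc a} {suc b} _ _ = subst (suc (suc a + suc a * suc (suc a * suc (2 * suc b))) ≤_) (slack a b) (m≤m+n _ _)
    where
    slack : ∀ a b → suc (suc a + suc a * suc (suc a * suc (2 * suc b)))
                      + (4 * a * a * b + 3 * a * a + 8 * a * b + 4 * a + 4 * b)
                    ≡ 6 * suc a * suc a * suc b
    slack = solve-∀

-- The host graph

module HostGraph (n a b : ℕ) (dsS dsT : List ℕ) (fits : size dsS * a + size dsT * b ≤ n) where

  leftBlock rightBlock spareCount : ℕ
  leftBlock = size dsS * a
  rightBlock = size dsT * b
  spareCount = n ∸ (leftBlock + rightBlock)

  n≡blocks : leftBlock + (spareCount + rightBlock) ≡ n
  n≡blocks = trans (cong (leftBlock +_) (+-comm spareCount rightBlock))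
               (trans (sym (+-assoc leftBlock rightBlock spareCount)) (m+[n∸m]≡n fits))

  data Vertex : Set where
    left  : Fin a → Node dsS → Vertex
    right : Fin b → Node dsT → Vertex
    spare : Fin spareCount → Vertex

  left-injective : ∀ {i i′ x x′} → left i x ≡ left i′ x′ → (i ≡ i′) × (x ≡ x′)
  left-injective refl = refl , refl

  right-injective : ∀ {j j′ y y′} → right j y ≡ right j′ y′ → (j ≡ j′) × (y ≡ y′)
  right-injective refl = refl , refl

  -- The left block is laid out upwards from 0 and the right block downwards from n - 1,
  -- copy i in residue class i, so the left tops get the indices 0, …, a - 1 and the
  -- right tops n - 1, …, n - b.
  index : Vertex → Fin n
  index (left i x) = cast n≡blocks (combine (encode x) i ↑ˡ (spareCount + rightBlock))
  index (spare k) = cast n≡blocks (leftBlock ↑ʳ (k ↑ˡ rightBlock))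
  index (right j y) = cast n≡blocks (leftBlock ↑ʳ (spareCount ↑ʳ opposite (combine (encode y) j)))

  vertex-right-or-spare : Fin spareCount ⊎ Fin rightBlock → Vertex
  vertex-right-or-spare (inj₁ k) = spare k
  vertex-right-or-spare (inj₂ w) =
    right (proj₂ (remQuot {size dsT} b (opposite w))) (decode (proj₁ (remQuot {size dsT} b (opposite w))))

  vertex-split : Fin leftBlock ⊎ Fin (spareCount + rightBlock) → Vertex
  vertex-split (inj₁ w) = left (proj₂ (remQuot {size dsS} a w)) (decode (proj₁ (remQuot {size dsS} a w)))
  vertex-split (inj₂ w) = vertex-right-or-spare (splitAt spareCount w)

  vertex : Fin n → Vertex
  vertex u = vertex-split (splitAt leftBlock (cast (sym n≡blocks) u))

  vertex-index : ∀ v → vertex (index v) ≡ v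
  vertex-index (left i x)
    rewrite cast-involutive (sym n≡blocks) n≡blocks (combine (encode x) i ↑ˡ (spareCount + rightBlock))
          | splitAt-↑ˡ leftBlock (combine (encode x) i) (spareCount + rightBlock)
    = trans (cong (λ r → left (proj₂ r) (decode (proj₁ r))) (remQuot-combine {size dsS} {a} (encode x) i))
            (cong (left i) (decode-encode x))
  vertex-index (spare k)
    rewrite cast-involutive (sym n≡blocks) n≡blocks (leftBlock ↑ʳ (k ↑ˡ rightBlock))
          | splitAt-↑ʳ leftBlock (spareCount + rightBlock) (k ↑ˡ rightBlock)
          | splitAt-↑ˡ spareCount k rightBlock = refl
  vertex-index (right j y)
    rewrite cast-involutive (sym n≡blocks) n≡blocks (leftBlock ↑ʳ (spareCount ↑ʳ opposite (combine (encode y) j)))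
          | splitAt-↑ʳ leftBlock (spareCount + rightBlock) (spareCount ↑ʳ opposite (combine (encode y) j))
          | splitAt-↑ʳ spareCount rightBlock (opposite (combine (encode y) j))
          | opposite-involutive (combine (encode y) j)
    = trans (cong (λ r → right (proj₂ r) (decode (proj₁ r))) (remQuot-combine {size dsT} {b} (encode y) j))
            (cong (right j) (decode-encode y))

  index-injective : ∀ {v w} → index v ≡ index w → v ≡ w
  index-injective {v} {w} eq = trans (sym (vertex-index v)) (trans (cong vertex eq) (vertex-index w))

  index-vertex : ∀ u → index (vertex u) ≡ u
  index-vertex u with splitAt leftBlock (cast (sym n≡blocks) u) in eq
  ... | inj₁ w = trans (cong (λ z → cast n≡blocks (z ↑ˡ (spareCount + rightBlock))) combine-w)
                   (trans (cong (cast n≡blocks) (splitAt⁻¹-↑ˡ eq)) (cast-involutive n≡blocks (sym n≡blocks) u))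
    where
    xi = remQuot {size dsS} a w
    combine-w : combine (encode (decode {dsS} (proj₁ xi))) (proj₂ xi) ≡ w
    combine-w = trans (cong (λ z → combine z (proj₂ xi)) (encode-decode (proj₁ xi))) (combine-remQuot {size dsS} a w)
  ... | inj₂ w with splitAt spareCount w in eq₂
  ...   | inj₁ k = trans (cong (λ z → cast n≡blocks (leftBlock ↑ʳ z)) (splitAt⁻¹-↑ˡ eq₂))
                     (trans (cong (cast n≡blocks) (splitAt⁻¹-↑ʳ eq)) (cast-involutive n≡blocks (sym n≡blocks) u))
  ...   | inj₂ w′ = trans (cong (λ z → cast n≡blocks (leftBlock ↑ʳ (spareCount ↑ʳ z))) combine-w′)
                     (trans (cong (λ z → cast n≡blocks (leftBlock ↑ʳ z)) (splitAt⁻¹-↑ʳ eq₂))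
                     (trans (cong (cast n≡blocks) (splitAt⁻¹-↑ʳ eq)) (cast-involutive n≡blocks (sym n≡blocks) u)))
    where
    yj = remQuot {size dsT} b (opposite w′)
    combine-w′ : opposite (combine (encode (decode {dsT} (proj₁ yj))) (proj₂ yj)) ≡ w′
    combine-w′ = trans (cong (λ z → opposite (combine z (proj₂ yj))) (encode-decode (proj₁ yj)))
                   (trans (cong opposite (combine-remQuot {size dsT} b (opposite w′))) (opposite-involutive w′))

  toℕ-index-left-top : ∀ i → toℕ (index (left i (top dsS))) ≡ toℕ i
  toℕ-index-left-top i = begin
    toℕ (cast n≡blocks (combine (encode (top dsS)) i ↑ˡ (spareCount + rightBlock))) ≡⟨ toℕ-cast n≡blocks _ ⟩
    toℕ (combine (encode (top dsS)) i ↑ˡ (spareCount + rightBlock))                 ≡⟨ toℕ-↑ˡ _ (spareCount + rightBlock) ⟩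
    toℕ (combine (encode (top dsS)) i)                                              ≡⟨ toℕ-combine (encode (top dsS)) i ⟩
    a * toℕ (encode (top dsS)) + toℕ i                                              ≡⟨ cong (λ z → a * z + toℕ i) (toℕ-encode-top dsS) ⟩
    a * 0 + toℕ i                                                                   ≡⟨ cong (_+ toℕ i) (*-zeroʳ a) ⟩
    toℕ i                                                                           ∎
    where open ≡-Reasoning

  toℕ-index-right-top : ∀ j → toℕ (index (right j (top dsT))) + suc (toℕ j) ≡ n
  toℕ-index-right-top j = begin
    toℕ (index (right j (top dsT))) + suc (toℕ j)                             ≡⟨ cong (_+ suc (toℕ j)) toℕ-index ⟩
    leftBlock + (spareCount + (rightBlock ∸ suc (toℕ j))) + suc (toℕ j)       ≡⟨ rearrange leftBlock spareCount (rightBlock ∸ suc (toℕ j)) (suc (toℕ j)) ⟩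
    leftBlock + (spareCount + (rightBlock ∸ suc (toℕ j) + suc (toℕ j)))       ≡⟨ cong (λ z → leftBlock + (spareCount + z)) (m∸n+n≡m j<rightBlock) ⟩
    leftBlock + (spareCount + rightBlock)                                     ≡⟨ n≡blocks ⟩
    n                                                                         ∎
    where
    open ≡-Reasoning
    c = combine (encode (top dsT)) j
    toℕ-c : toℕ c ≡ toℕ j
    toℕ-c = trans (toℕ-combine (encode (top dsT)) j)
              (trans (cong (λ z → b * z + toℕ j) (toℕ-encode-top dsT)) (cong (_+ toℕ j) (*-zeroʳ b)))
    toℕ-index : toℕ (index (right j (top dsT))) ≡ leftBlock + (spareCount + (rightBlock ∸ suc (toℕ j)))
    toℕ-index = trans (toℕ-cast n≡blocks _) (trans (toℕ-↑ʳ leftBlock _) (cong (leftBlock +_) (trans (toℕ-↑ʳ spareCount _)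
                  (cong (spareCount +_) (trans (opposite-prop c) (cong (λ z → rightBlock ∸ suc z) toℕ-c))))))
    rearrange : ∀ a b c d → a + (b + c) + d ≡ a + (b + (c + d))
    rearrange = solve-∀
    size-nonZero : ∀ ds → NonZero (size ds)
    size-nonZero [] = _
    size-nonZero (d ∷ ds) = _
    j<rightBlock : suc (toℕ j) ≤ rightBlock
    j<rightBlock = ≤-trans (toℕ<n j) (m≤n*m b (size dsT) ⦃ size-nonZero dsT ⦄)

  data Adjacent : Vertex → Vertex → Set where
    left-link  : ∀ i {x y} → Link x y → Adjacent (left i x) (left i y)
    right-link : ∀ j {x y} → Link x y → Adjacent (right j x) (right j y)
    cross      : ∀ i j {x y} → IsLeaf x → IsLeaf y → Adjacent (left i x) (right j y)

  Adjacent? : ∀ v w → Dec (Adjacent v w)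
  Adjacent? (left i x) (left i′ y) with i Fin.≟ i′ | Link? x y
  ... | yes refl | yes e = yes (left-link i e)
  ... | no i≢i′ | _ = no λ { (left-link _ _) → i≢i′ refl }
  ... | yes refl | no ¬e = no λ { (left-link _ e) → ¬e e }
  Adjacent? (left i x) (right j y) with IsLeaf? x | IsLeaf? y
  ... | yes x-leaf | yes y-leaf = yes (cross i j x-leaf y-leaf)
  ... | no ¬x-leaf | _ = no λ { (cross _ _ x-leaf _) → ¬x-leaf x-leaf }
  ... | yes _ | no ¬y-leaf = no λ { (cross _ _ _ y-leaf) → ¬y-leaf y-leaf }
  Adjacent? (left _ _) (spare _) = no λ ()
  Adjacent? (right _ _) (left _ _) = no λ ()
  Adjacent? (right j x) (right j′ y) with j Fin.≟ j′ | Link? x y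
  ... | yes refl | yes e = yes (right-link j e)
  ... | no j≢j′ | _ = no λ { (right-link _ _) → j≢j′ refl }
  ... | yes refl | no ¬e = no λ { (right-link _ e) → ¬e e }
  Adjacent? (right _ _) (spare _) = no λ ()
  Adjacent? (spare _) _ = no λ ()

  Adjacent-irrefl : ∀ {v} → ¬ Adjacent v v
  Adjacent-irrefl (left-link i e) = Link-irrefl e
  Adjacent-irrefl (right-link j e) = Link-irrefl e

  Adjacentˢ : Vertex → Vertex → Set
  Adjacentˢ v w = Adjacent v w ⊎ Adjacent w v

  Adjacentˢ-irrefl : ∀ {v w} → Adjacentˢ v w → v ≢ w
  Adjacentˢ-irrefl (inj₁ e) refl = Adjacent-irrefl e
  Adjacentˢ-irrefl (inj₂ e) refl = Adjacent-irrefl e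

  IsHostEdge : Edge n → Set
  IsHostEdge (u , v) = (toℕ u < toℕ v) × Adjacentˢ (vertex u) (vertex v)

  IsHostEdge? : ∀ e → Dec (IsHostEdge e)
  IsHostEdge? (u , v) = (toℕ u <? toℕ v) ×-dec (Adjacent? (vertex u) (vertex v) ⊎-dec Adjacent? (vertex v) (vertex u))

  allPairs : List (Edge n)
  allPairs = cartesianProduct (allFin n) (allFin n)

  host : Graph n
  host = record
    { edges = filter IsHostEdge? allPairs
    ; ordered = All.map proj₁ (all-filter IsHostEdge? allPairs)
    ; unique = filter⁺ IsHostEdge? (cartesianProduct⁺ (allFin⁺ n) (allFin⁺ n)) }

  IsHostEdge⇒∈ : ∀ {e} → IsHostEdge e → e ∈ edges host
  IsHostEdge⇒∈ = ∈-filter⁺ IsHostEdge? (∈-cartesianProduct⁺ (∈-allFin _) (∈-allFin _))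

  ∈⇒IsHostEdge : ∀ {e} → e ∈ edges host → IsHostEdge e
  ∈⇒IsHostEdge m = proj₂ (∈-filter⁻ IsHostEdge? {xs = allPairs} m)

  orient : Fin n → Fin n → Edge n
  orient u v with toℕ u <? toℕ v
  ... | yes _ = u , v
  ... | no _ = v , u

  orient-< : ∀ {u v} → toℕ u < toℕ v → orient u v ≡ (u , v)
  orient-< {u} {v} u<v with toℕ u <? toℕ v
  ... | yes _ = refl
  ... | no u≮v = ⊥-elim (u≮v u<v)

  orient-> : ∀ {u v} → toℕ v < toℕ u → orient u v ≡ (v , u)
  orient-> {u} {v} v<u with toℕ u <? toℕ v
  ... | yes u<v = ⊥-elim (<-asym u<v v<u)
  ... | no _ = refl

  orient-injective : ∀ u v u′ v′ → orient u v ≡ orient u′ v′ → ((u ≡ u′) × (v ≡ v′)) ⊎ ((u ≡ v′) × (v ≡ u′))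
  orient-injective u v u′ v′ eq with toℕ u <? toℕ v | toℕ u′ <? toℕ v′
  ... | yes _ | yes _ = inj₁ (cong proj₁ eq , cong proj₂ eq)
  ... | yes _ | no _ = inj₂ (cong proj₁ eq , cong proj₂ eq)
  ... | no _ | yes _ = inj₂ (cong proj₂ eq , cong proj₁ eq)
  ... | no _ | no _ = inj₁ (cong proj₂ eq , cong proj₁ eq)

  edgeOf : Vertex × Vertex → Edge n
  edgeOf (v , w) = orient (index v) (index w)

  edgeOf-∈-host : ∀ {v w} → Adjacentˢ v w → edgeOf (v , w) ∈ edges host
  edgeOf-∈-host {v} {w} adj with <-cmp (toℕ (index v)) (toℕ (index w))
  ... | tri< v<w _ _ rewrite orient-< {index v} {index w} v<w =
    IsHostEdge⇒∈ (v<w , subst₂ Adjacentˢ (sym (vertex-index v)) (sym (vertex-index w)) adj)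
  ... | tri≈ _ v≡w _ = ⊥-elim (Adjacentˢ-irrefl adj (index-injective (toℕ-injective v≡w)))
  ... | tri> _ _ w<v rewrite orient-> {index v} {index w} w<v =
    IsHostEdge⇒∈ (w<v , subst₂ Adjacentˢ (sym (vertex-index w)) (sym (vertex-index v)) (swap adj))

  module _ (Φ : Vertex → ℕ) (C : List (Vertex × Vertex)) (F : List (Edge n))
           (C⊆F : ∀ {v w} → (v , w) ∈ C → edgeOf (v , w) ∈ F)
           (Φ-≈₁ : ∀ {v w} → Adjacent v w → (v , w) ∉ C → (w , v) ∉ C → Φ v ≈₁ Φ w) where

    host-edge-≈₁ : ∀ {u v} → (u , v) ∈ edges host → (u , v) ∉ F → Φ (vertex u) ≈₁ Φ (vertex v)
    host-edge-≈₁ {u} {v} m u,v∉F with ∈⇒IsHostEdge m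
    ... | u<v , adj = [ (λ adj → Φ-≈₁ adj (∉C forward) (∉C backward)) ,
                        (λ adj → ≈₁-sym (Φ-≈₁ adj (∉C backward) (∉C forward))) ] adj
      where
      forward : edgeOf (vertex u , vertex v) ≡ (u , v)
      forward = trans (cong₂ orient (index-vertex u) (index-vertex v)) (orient-< u<v)
      backward : edgeOf (vertex v , vertex u) ≡ (u , v)
      backward = trans (cong₂ orient (index-vertex v) (index-vertex u)) (orient-> u<v)
      ∉C : ∀ {p} → edgeOf p ≡ (u , v) → p ∉ C
      ∉C eq m = u,v∉F (subst (_∈ F) eq (C⊆F m))

    walk-bound : ∀ {u v k} → Walk (Adj host F) u v k → Φ (vertex v) ≤ Φ (vertex u) + k
    walk-bound = walk-potential (λ u → Φ (vertex u)) Adj-≈₁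
      where
      Adj-≈₁ : ∀ {u v} → Adj host F u v → Φ (vertex u) ≈₁ Φ (vertex v)
      Adj-≈₁ (inj₁ (m , ∉F)) = host-edge-≈₁ m ∉F
      Adj-≈₁ (inj₂ (m , ∉F)) = ≈₁-sym (host-edge-≈₁ m ∉F)

  _≟ₑ_ : (e e′ : Edge n) → Dec (e ≡ e′)
  _≟ₑ_ = ≡-dec Fin._≟_ Fin._≟_

  open import Data.List.Membership.DecPropositional _≟ₑ_ using () renaming (_∈?_ to _∈ₑ?_)

  module Faults (C : List (Vertex × Vertex)) where

    faults : List (Edge n)
    faults = deduplicate _≟ₑ_ (map edgeOf C)

    faults-unique : Unique faults
    faults-unique = deduplicate-! _≟ₑ_ (map edgeOf C)

    length-faults : length faults ≤ length C
    length-faults = ≤-trans (length-deduplicate _≟ₑ_ (map edgeOf C)) (≤-reflexive (length-map edgeOf C))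

    Intact : Vertex → Vertex → Set
    Intact v w = Adjacentˢ v w × ((v , w) ∉ C) × ((w , v) ∉ C)

    edgeOf-∉-faults : ∀ {v w} → (v , w) ∉ C → (w , v) ∉ C → edgeOf (v , w) ∉ faults
    edgeOf-∉-faults {v} {w} ∉vw ∉wv m with ∈-map⁻ edgeOf (∈-deduplicate⁻ _≟ₑ_ (map edgeOf C) m)
    ... | (v′ , w′) , m′ , eq with orient-injective (index v) (index w) (index v′) (index w′) eq
    ... | inj₁ (e₁ , e₂) = ∉vw (subst (_∈ C) (cong₂ _,_ (sym (index-injective e₁)) (sym (index-injective e₂))) m′)
    ... | inj₂ (e₁ , e₂) = ∉wv (subst (_∈ C) (cong₂ _,_ (sym (index-injective e₂)) (sym (index-injective e₁))) m′)

    Intact⇒Adj : ∀ {v w} → Intact v w → Adj host faults (index v) (index w)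
    Intact⇒Adj {v} {w} (adj , ∉vw , ∉wv) with <-cmp (toℕ (index v)) (toℕ (index w))
    ... | tri< v<w _ _ = inj₁ (subst (_∈ edges host) (orient-< v<w) (edgeOf-∈-host adj) ,
                               subst (_∉ faults) (orient-< v<w) (edgeOf-∉-faults ∉vw ∉wv))
    ... | tri≈ _ v≡w _ = ⊥-elim (Adjacentˢ-irrefl adj (index-injective (toℕ-injective v≡w)))
    ... | tri> _ _ w<v = inj₂ (subst (_∈ edges host) (orient-> w<v) (edgeOf-∈-host adj) ,
                               subst (_∉ faults) (orient-> w<v) (edgeOf-∉-faults ∉vw ∉wv))

    chain⇒walk : ∀ {v w k} → Chain Intact v w k → Walk (Adj host faults) (index v) (index w) k
    chain⇒walk ε = here
    chain⇒walk (r ◅ c) = step (Intact⇒Adj r) (chain⇒walk c)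

  inLeft : Fin a → Node dsS × Node dsS → Vertex × Vertex
  inLeft i (x , y) = left i x , left i y

  inRight : Fin b → Node dsT × Node dsT → Vertex × Vertex
  inRight j (x , y) = right j x , right j y

  crossEdge : Fin a → Address dsS → Fin b → Address dsT → Edge n
  crossEdge i l j m = edgeOf (left i (leaf l) , right j (leaf m))

  module Spanners (f′ : ℕ) (few-cuts : length dsS + length dsT ≤ f′) (S T : Subset n)
    (left-tops∈S : ∀ i → index (left i (top dsS)) ∈ₛ S) (right-tops∈T : ∀ j → index (right j (top dsT)) ∈ₛ T) where

    module _ (i₀ : Fin a) (l : Address dsS) (j₀ : Fin b) (m : Address dsT) where

      cutPairs : List (Vertex × Vertex)
      cutPairs = map (inLeft i₀) (cuts l) ++ map (inRight j₀) (cuts m)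

      open Faults cutPairs

      ∈-cutPairs⁻ : ∀ {v w} → (v , w) ∈ cutPairs →
        (Σ (Node dsS) λ x → Σ (Node dsS) λ y → (v ≡ left i₀ x) × (w ≡ left i₀ y) × ((x , y) ∈ cuts l)) ⊎
        (Σ (Node dsT) λ x → Σ (Node dsT) λ y → (v ≡ right j₀ x) × (w ≡ right j₀ y) × ((x , y) ∈ cuts m))
      ∈-cutPairs⁻ p with ∈-++⁻ (map (inLeft i₀) (cuts l)) p
      ... | inj₁ p′ with ∈-map⁻ (inLeft i₀) p′
      ...   | (x , y) , q , refl = inj₁ (x , y , refl , refl , q)
      ∈-cutPairs⁻ p | inj₂ p′ with ∈-map⁻ (inRight j₀) p′
      ...   | (x , y) , q , refl = inj₂ (x , y , refl , refl , q)

      faults⊆host : ∀ {e} → e ∈ faults → e ∈ edges host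
      faults⊆host p with ∈-map⁻ edgeOf (∈-deduplicate⁻ _≟ₑ_ (map edgeOf cutPairs) p)
      ... | (v , w) , q , refl with ∈-cutPairs⁻ q
      ...   | inj₁ (_ , _ , refl , refl , r) = edgeOf-∈-host (inj₁ (left-link i₀ (cuts⊆Link l r)))
      ...   | inj₂ (_ , _ , refl , refl , r) = edgeOf-∈-host (inj₁ (right-link j₀ (cuts⊆Link m r)))

      length-faults≤ : length faults ≤ f′
      length-faults≤ = begin
        length faults                                                      ≤⟨ length-faults ⟩
        length cutPairs                                                    ≡⟨ length-++ (map (inLeft i₀) (cuts l)) ⟩
        length (map (inLeft i₀) (cuts l)) + length (map (inRight j₀) (cuts m)) ≡⟨ cong₂ _+_ (length-map (inLeft i₀) (cuts l)) (length-map (inRight j₀) (cuts m)) ⟩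
        length (cuts l) + length (cuts m)                                  ≤⟨ +-mono-≤ (length-cuts l) (length-cuts m) ⟩
        length dsS + length dsT                                            ≤⟨ few-cuts ⟩
        f′                                                                 ∎
        where open ≤-Reasoning

      left-∉ : ∀ {x y} → (x , y) ∉ cuts l → (left i₀ x , left i₀ y) ∉ cutPairs
      left-∉ ∉xy p with ∈-cutPairs⁻ p
      ... | inj₁ (_ , _ , refl , refl , q) = ∉xy q
      ... | inj₂ (_ , _ , () , _)

      right-∉ : ∀ {x y} → (x , y) ∉ cuts m → (right j₀ x , right j₀ y) ∉ cutPairs
      right-∉ ∉xy p with ∈-cutPairs⁻ p
      ... | inj₁ (_ , _ , () , _)
      ... | inj₂ (_ , _ , refl , refl , q) = ∉xy q

      left-right-∉ : ∀ {x y} → (left i₀ x , right j₀ y) ∉ cutPairs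
      left-right-∉ p with ∈-cutPairs⁻ p
      ... | inj₁ (_ , _ , _ , () , _)
      ... | inj₂ (_ , _ , () , _)

      right-left-∉ : ∀ {x y} → (right j₀ y , left i₀ x) ∉ cutPairs
      right-left-∉ p with ∈-cutPairs⁻ p
      ... | inj₁ (_ , _ , () , _)
      ... | inj₂ (_ , _ , _ , () , _)

      A B : ℕ
      A = depth (leaf l)
      B = depth (leaf m)

      top-chain : Chain Intact (left i₀ (top dsS)) (right j₀ (top dsT)) (A + suc B)
      top-chain =
        chain-map (left i₀) (λ { (e , ∉xy , ∉yx) → inj₁ (left-link i₀ e) , left-∉ ∉xy , left-∉ ∉yx }) (top-to-leaf l)
        ◅◅ (inj₁ (cross i₀ j₀ (leaf-IsLeaf l) (leaf-IsLeaf m)) , left-right-∉ , right-left-∉)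
        ◅ chain-map (right j₀) (λ { (e , ∉yx , ∉xy) → inj₂ (right-link j₀ e) , right-∉ ∉xy , right-∉ ∉yx })
            (chain-reverse (top-to-leaf m))

      -- Φ climbs from 0 at the top of left copy i₀ to A at leaf l, and from A + 3 at
      -- leaf m to A + B + 3 at the top of right copy j₀: only the cross edge between
      -- leaf l and leaf m bridges the gap of 3.
      Φ : Vertex → ℕ
      Φ (left i x) = if ⌊ i Fin.≟ i₀ ⌋ then potential l x else cap l
      Φ (right j y) = suc A + (cap m ∸ (if ⌊ j Fin.≟ j₀ ⌋ then potential m y else cap m))
      Φ (spare _) = 0

      Φ-left-leaf : ∀ i {x} → IsLeaf x → ((i ≡ i₀) × (x ≡ leaf l) × (Φ (left i x) ≡ A)) ⊎ (Φ (left i x) ≡ A + 2)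
      Φ-left-leaf i x-leaf with i Fin.≟ i₀
      ... | no _ = inj₂ refl
      ... | yes i≡i₀ with potential-IsLeaf l x-leaf
      ...   | inj₁ refl = inj₁ (i≡i₀ , refl , potential-leaf l)
      ...   | inj₂ capped = inj₂ capped

      Φ-right-leaf : ∀ j {y} → IsLeaf y → ((j ≡ j₀) × (y ≡ leaf m) × (Φ (right j y) ≡ suc A + 2)) ⊎ (Φ (right j y) ≡ suc A + 0)
      Φ-right-leaf j y-leaf with j Fin.≟ j₀
      ... | no _ = inj₂ (cong (suc A +_) (n∸n≡0 (cap m)))
      ... | yes j≡j₀ with potential-IsLeaf m y-leaf
      ...   | inj₁ refl = inj₁ (j≡j₀ , refl , cong (suc A +_) (trans (cong (cap m ∸_) (potential-leaf m)) (m+n∸m≡n B 2)))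
      ...   | inj₂ capped = inj₂ (cong (suc A +_) (trans (cong (cap m ∸_) capped) (n∸n≡0 (cap m))))

      removed : List (Vertex × Vertex)
      removed = (left i₀ (leaf l) , right j₀ (leaf m)) ∷ cutPairs

      Φ-≈₁ : ∀ {v w} → Adjacent v w → (v , w) ∉ removed → (w , v) ∉ removed → Φ v ≈₁ Φ w
      Φ-≈₁ (left-link i e) ∉vw _ with i Fin.≟ i₀
      ... | yes refl = potential-≈₁ l e (λ p → ∉vw (there (∈-++⁺ˡ (∈-map⁺ (inLeft i₀) p))))
      ... | no _ = ≈₁-refl _
      Φ-≈₁ (right-link j e) ∉vw _ with j Fin.≟ j₀
      ... | yes refl = +-monoʳ-≈₁ (suc A) (∸-monoʳ-≈₁ (cap m)
                         (potential-≈₁ m e (λ p → ∉vw (there (∈-++⁺ʳ (map (inLeft i₀) (cuts l)) (∈-map⁺ (inRight j₀) p))))))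
      ... | no _ = ≈₁-refl _
      Φ-≈₁ (cross i j x-leaf y-leaf) ∉vw _ with Φ-left-leaf i x-leaf | Φ-right-leaf j y-leaf
      ... | inj₁ (refl , refl , _) | inj₁ (refl , refl , _) = ⊥-elim (∉vw (here refl))
      ... | inj₁ (_ , _ , p) | inj₂ q = subst₂ _≈₁_ (sym p) (sym q) (subst (A ≈₁_) (sym (+-identityʳ (suc A))) (n≈₁1+n A))
      ... | inj₂ p | inj₁ (_ , _ , q) = subst₂ _≈₁_ (sym p) (sym q) (n≈₁1+n (A + 2))
      ... | inj₂ p | inj₂ q = subst₂ _≈₁_ (sym p) (sym q)
                                (subst₂ _≈₁_ (+-comm 2 A) (sym (+-identityʳ (suc A))) (≈₁-sym (n≈₁1+n (suc A))))

      Φ-left-top : Φ (vertex (index (left i₀ (top dsS)))) ≡ 0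
      Φ-left-top rewrite vertex-index (left i₀ (top dsS)) with i₀ Fin.≟ i₀
      ... | yes _ = potential-top l (top-IsTop dsS)
      ... | no i₀≢i₀ = ⊥-elim (i₀≢i₀ refl)

      Φ-right-top : Φ (vertex (index (right j₀ (top dsT)))) ≡ suc A + cap m
      Φ-right-top rewrite vertex-index (right j₀ (top dsT)) with j₀ Fin.≟ j₀
      ... | yes _ = cong (λ z → suc A + (cap m ∸ z)) (potential-top m (top-IsTop dsT))
      ... | no j₀≢j₀ = ⊥-elim (j₀≢j₀ refl)

      removed⊆ : ∀ {v w} → (v , w) ∈ removed → edgeOf (v , w) ∈ crossEdge i₀ l j₀ m ∷ faults
      removed⊆ (here refl) = here refl
      removed⊆ (there p) = there (∈-deduplicate⁺ _≟ₑ_ (∈-map⁺ edgeOf p))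

      cross-edge-∈ : (H : Graph n) → IsFTAdditiveSTSpanner host H f′ 1 S T → crossEdge i₀ l j₀ m ∈ edges H
      cross-edge-∈ H (H⊆host , spanner) with crossEdge i₀ l j₀ m ∈ₑ? edges H
      ... | yes e∈H = e∈H
      ... | no e∉H = ⊥-elim (1+n≰n (begin
        suc (A + (B + 2))        ≡⟨ Φ-right-top ⟨
        Φ (vertex t)             ≤⟨ walk-bound Φ removed (crossEdge i₀ l j₀ m ∷ faults) removed⊆ Φ-≈₁ (walk-map avoids detour) ⟩
        Φ (vertex s) + k         ≡⟨ cong (_+ k) Φ-left-top ⟩
        k                        ≤⟨ k≤ ⟩
        A + suc B + 1            ≡⟨ rearrange A B ⟩
        A + (B + 2)              ∎))
        where
        open ≤-Reasoning
        s = index (left i₀ (top dsS))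
        t = index (right j₀ (top dsT))
        stretch = spanner faults faults-unique faults⊆host length-faults≤ s t (left-tops∈S i₀ , right-tops∈T j₀)
                    (A + suc B) (A + suc B , ≤-refl , chain⇒walk top-chain)
        k = proj₁ stretch
        k≤ = proj₁ (proj₂ stretch)
        detour = proj₂ (proj₂ stretch)
        avoid : ∀ {e} → e ∈ edges H → e ∉ faults → e ∉ crossEdge i₀ l j₀ m ∷ faults
        avoid e∈H _ (here refl) = e∉H e∈H
        avoid _ e∉F (there p) = e∉F p
        avoids : ∀ {u v} → Adj H faults u v → Adj host (crossEdge i₀ l j₀ m ∷ faults) u v
        avoids (inj₁ (p , q)) = inj₁ (H⊆host p , avoid p q)
        avoids (inj₂ (p , q)) = inj₂ (H⊆host p , avoid p q)
        rearrange : ∀ A B → A + suc B + 1 ≡ A + (B + 2)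
        rearrange = solve-∀

    Crossing : Set
    Crossing = Fin a × Fin (product dsS) × Fin b × Fin (product dsT)

    crossing : Fin (a * product dsS * (b * product dsT)) → Crossing
    crossing u = proj₁ (remQuot (product dsS) (proj₁ r)) , proj₂ (remQuot {a} (product dsS) (proj₁ r)) ,
                 proj₁ (remQuot (product dsT) (proj₂ r)) , proj₂ (remQuot {b} (product dsT) (proj₂ r))
      where r = remQuot {a * product dsS} (b * product dsT) u

    crossing-injective : ∀ u u′ → crossing u ≡ crossing u′ → u ≡ u′
    crossing-injective u u′ eq = begin
      u                          ≡⟨ combine-remQuot {a * product dsS} (b * product dsT) u ⟨
      combine (proj₁ r) (proj₂ r) ≡⟨ cong₂ combine
        (trans (sym (combine-remQuot {a} (product dsS) (proj₁ r)))
          (trans (cong₂ combine (cong proj₁ eq) (cong (proj₁ ∘ proj₂) eq)) (combine-remQuot {a} (product dsS) (proj₁ r′))))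
        (trans (sym (combine-remQuot {b} (product dsT) (proj₂ r)))
          (trans (cong₂ combine (cong (proj₁ ∘ proj₂ ∘ proj₂) eq) (cong (proj₂ ∘ proj₂ ∘ proj₂) eq)) (combine-remQuot {b} (product dsT) (proj₂ r′)))) ⟩
      combine (proj₁ r′) (proj₂ r′) ≡⟨ combine-remQuot {a * product dsS} (b * product dsT) u′ ⟩
      u′                          ∎
      where
      open ≡-Reasoning
      r = remQuot {a * product dsS} (b * product dsT) u
      r′ = remQuot {a * product dsS} (b * product dsT) u′

    crossingEdge : Crossing → Edge n
    crossingEdge (i , u , j , v) = crossEdge i (address u) j (address v)

    crossingEdge-injective : ∀ c c′ → crossingEdge c ≡ crossingEdge c′ → c ≡ c′
    crossingEdge-injective (i , u , j , v) (i′ , u′ , j′ , v′) eq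
      with orient-injective (index (left i (leaf (address u)))) (index (right j (leaf (address v))))
                            (index (left i′ (leaf (address u′)))) (index (right j′ (leaf (address v′)))) eq
    ... | inj₂ (e , _) with index-injective {left i (leaf (address u))} {right j′ (leaf (address v′))} e
    ...   | ()
    crossingEdge-injective (i , u , j , v) (i′ , u′ , j′ , v′) eq | inj₁ (e₁ , e₂)
      with left-injective (index-injective e₁) | right-injective (index-injective e₂)
    ... | refl , x≡x′ | refl , y≡y′
      rewrite address-injective u u′ (leaf-injective _ _ x≡x′) | address-injective v v′ (leaf-injective _ _ y≡y′) = refl

    crossings≤∣E∣ : (H : Graph n) → IsFTAdditiveSTSpanner host H f′ 1 S T → a * product dsS * (b * product dsT) ≤ ∣E∣ H
    crossings≤∣E∣ H spanner = injective⇒≤ {f = position} position-injective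
      where
      crossingEdge-∈ : ∀ c → crossingEdge c ∈ edges H
      crossingEdge-∈ (i , u , j , v) = cross-edge-∈ i (address u) j (address v) H spanner
      contained : ∀ u → crossingEdge (crossing u) ∈ edges H
      contained u = crossingEdge-∈ (crossing u)
      position : Fin (a * product dsS * (b * product dsT)) → Fin (∣E∣ H)
      position u = Any.index (contained u)
      position-injective : ∀ {u u′} → position u ≡ position u′ → u ≡ u′
      position-injective {u} {u′} eq = crossing-injective u u′ (crossingEdge-injective (crossing u) (crossing u′)
        (trans (lookup-index (contained u)) (trans (cong (lookup (edges H)) eq) (sym (lookup-index (contained u′))))))

-- Choice of the parameters

product-replicate : ∀ k x → product (replicate k x) ≡ x ^ k
product-replicate zero x = refl
product-replicate (suc k) x = cong (x *_) (product-replicate k x)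

sum-replicate : ∀ k x → sum (replicate k x) ≡ k * x
sum-replicate zero x = refl
sum-replicate (suc k) x = cong (x +_) (sum-replicate k x)

All-replicate : ∀ {P : ℕ → Set} k {x} → P x → All P (replicate k x)
All-replicate zero _ = []
All-replicate (suc k) px = px ∷ All-replicate k px

-- With d = ⌊X^(1/(f+1))⌋, take j copies of d + 1 and f - j copies of d, for the largest j
-- keeping product · d ≤ X; then X ≤ product · (d + 1) ≤ 2 · product · d.
module MixedBranching (f d X : ℕ) (1≤d : 1 ≤ d) (d^[1+f]≤X : d ^ suc f ≤ X) (X<[1+d]^[1+f] : X < suc d ^ suc f) where

  productAt : ℕ → ℕ
  productAt j = suc d ^ j * d ^ (f ∸ j)

  branchingAt : ℕ → List ℕ
  branchingAt j = replicate j (suc d) ++ replicate (f ∸ j) d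

  Fits : ℕ → Set
  Fits j = productAt j * d ≤ X

  private
    fits-0 : Fits 0
    fits-0 = subst (_≤ X) (trans (*-comm d (d ^ f)) (cong (_* d) (sym (+-identityʳ (d ^ f))))) d^[1+f]≤X

    largest = scan-up Fits (λ j → productAt j * d ≤? X) f 0 fits-0

  j : ℕ
  j = proj₁ largest

  j≤f : j ≤ f
  j≤f = proj₁ (proj₂ (proj₂ largest))

  branching : List ℕ
  branching = branchingAt j

  product-branching : product branching ≡ productAt j
  product-branching = trans (product-++ (replicate j (suc d)) _) (cong₂ _*_ (product-replicate j (suc d)) (product-replicate (f ∸ j) d))

  length-branching : length branching ≡ f
  length-branching =
    trans (length-++ (replicate j (suc d))) (trans (cong₂ _+_ (length-replicate j) (length-replicate (f ∸ j))) (m+[n∸m]≡n j≤f))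

  branching-positive : All (1 ≤_) branching
  branching-positive = All-++⁺ (All-replicate j (s≤s z≤n)) (All-replicate (f ∸ j) 1≤d)

  sum-branching≤ : sum branching ≤ f * suc d
  sum-branching≤ = begin
    sum branching                  ≡⟨ trans (sum-++ (replicate j (suc d)) _) (cong₂ _+_ (sum-replicate j (suc d)) (sum-replicate (f ∸ j) d)) ⟩
    j * suc d + (f ∸ j) * d        ≤⟨ +-monoʳ-≤ (j * suc d) (*-monoʳ-≤ (f ∸ j) (n≤1+n d)) ⟩
    j * suc d + (f ∸ j) * suc d    ≡⟨ *-distribʳ-+ (suc d) j (f ∸ j) ⟨
    (j + (f ∸ j)) * suc d          ≡⟨ cong (_* suc d) (m+[n∸m]≡n j≤f) ⟩
    f * suc d                      ∎
    where open ≤-Reasoning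

  product-branching*d≤X : product branching * d ≤ X
  product-branching*d≤X = subst (λ z → z * d ≤ X) (sym product-branching) (proj₁ (proj₂ (proj₂ (proj₂ largest))))

  maximal : (j ≡ f) ⊎ ¬ Fits (suc j)
  maximal = proj₂ (proj₂ (proj₂ (proj₂ largest)))

  X≤productAt-j*[1+d] : X ≤ productAt j * suc d
  X≤productAt-j*[1+d] with j ≟ f
  ... | yes j≡f = begin
    X                                ≤⟨ <⇒≤ X<[1+d]^[1+f] ⟩
    suc d * suc d ^ f                ≡⟨ rearrange (suc d) (suc d ^ f) ⟩
    suc d ^ f * d ^ 0 * suc d        ≡⟨ cong (λ z → suc d ^ f * d ^ z * suc d) (n∸n≡0 f) ⟨
    productAt f * suc d              ≡⟨ cong (λ z → productAt z * suc d) j≡f ⟨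
    productAt j * suc d              ∎
    where
    open ≤-Reasoning
    rearrange : ∀ a b → a * b ≡ b * 1 * a
    rearrange = solve-∀
  ... | no j≢f = begin
    X                                          ≤⟨ <⇒≤ (≰⇒> ¬fits) ⟩
    productAt (suc j) * d                      ≡⟨ rearrange (suc d ^ j) (d ^ (f ∸ suc j)) d (suc d) ⟩
    suc d ^ j * (d * d ^ (f ∸ suc j)) * suc d  ≡⟨ cong (λ z → suc d ^ j * d ^ z * suc d) (+-∸-assoc 1 (≤∧≢⇒< j≤f j≢f)) ⟨
    productAt j * suc d                        ∎
    where
    open ≤-Reasoning
    ¬fits : ¬ Fits (suc j)
    ¬fits = [ (λ j≡f → ⊥-elim (j≢f j≡f)) , id ]′ maximal
    rearrange : ∀ a b c sd → sd * a * b * c ≡ a * (c * b) * sd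
    rearrange = solve-∀

  X^f≤product^[1+f]*2^[1+f] : X ^ f ≤ product branching ^ suc f * 2 ^ suc f
  X^f≤product^[1+f]*2^[1+f] = *-cancelˡ-≤ X ⦃ X≢0 ⦄ (begin
    X * X ^ f                       ≤⟨ ^-monoˡ-≤ (suc f) X≤L*[1+d] ⟩
    (L * suc d) ^ suc f             ≡⟨ ^-distribʳ-* L (suc d) (suc f) ⟩
    L ^ suc f * suc d ^ suc f       ≤⟨ *-monoʳ-≤ (L ^ suc f) (^-monoˡ-≤ (suc f) 1+d≤2*d) ⟩
    L ^ suc f * (2 * d) ^ suc f     ≡⟨ cong (L ^ suc f *_) (^-distribʳ-* 2 d (suc f)) ⟩
    L ^ suc f * (2 ^ suc f * d ^ suc f) ≤⟨ *-monoʳ-≤ (L ^ suc f) (*-monoʳ-≤ (2 ^ suc f) d^[1+f]≤X) ⟩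
    L ^ suc f * (2 ^ suc f * X)     ≡⟨ rearrange (L ^ suc f) (2 ^ suc f) X ⟩
    X * (L ^ suc f * 2 ^ suc f)     ∎)
    where
    open ≤-Reasoning
    L = product branching
    X≤L*[1+d] : X ≤ L * suc d
    X≤L*[1+d] = subst (λ z → X ≤ z * suc d) (sym product-branching) X≤productAt-j*[1+d]
    1+d≤2*d : suc d ≤ 2 * d
    1+d≤2*d = subst (suc d ≤_) (cong (d +_) (sym (+-identityʳ d))) (+-monoˡ-≤ d 1≤d)
    X≢0 : NonZero X
    X≢0 = >-nonZero (≤-trans 1≤d (≤-trans (m≤m^[1+n] d f 1≤d) d^[1+f]≤X))
    rearrange : ∀ a b c → a * (b * c) ≡ c * (a * b)
    rearrange = solve-∀

K : ℕ
K = 208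

record Plan (f n a : ℕ) : Set where
  field
    copies    : ℕ
    branching : List ℕ
    copies≤   : copies ≤ a
    length≤   : length branching ≤ f
    positive  : All (1 ≤_) branching
    fits      : 2 * (size branching * copies) ≤ n
    bound     : a * n ^ f ≤ K ^ (f + 1) * f ^ f * (copies * product branching) ^ (f + 1)

plan-none : ∀ f n → Plan f n 0
plan-none f n = record
  { copies = 0 ; branching = [] ; copies≤ = z≤n ; length≤ = z≤n ; positive = [] ; fits = z≤n ; bound = z≤n }

n≤3*[n/2] : ∀ n → 2 ≤ n → n ≤ 3 * (n / 2)
n≤3*[n/2] n 2≤n = begin
  n               ≡⟨ m≡m%n+[m/n]*n n 2 ⟩
  n % 2 + q * 2   ≤⟨ +-monoˡ-≤ (q * 2) (≤-trans (≤-pred (m%n<n n 2)) (/-monoˡ-≤ 2 2≤n)) ⟩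
  q + q * 2       ≡⟨ rearrange q ⟩
  3 * q           ∎
  where
  open ≤-Reasoning
  q = n / 2
  rearrange : ∀ q → q + q * 2 ≡ 3 * q
  rearrange = solve-∀

-- Few vertices per terminal: single-vertex gadgets, one per terminal, up to n / 2 of them.
plan-trivial : ∀ f n a → 2 ≤ n → a ≤ n → n < 52 * f * a → Plan f n a
plan-trivial f n a 2≤n a≤n n<52fa = record
  { copies = c ; branching = [] ; copies≤ = m⊓n≤m a (n / 2) ; length≤ = z≤n ; positive = []
  ; fits = ≤-trans (*-monoʳ-≤ 2 (≤-trans (≤-reflexive (+-identityʳ c)) (m⊓n≤n a (n / 2))))
                   (subst (_≤ n) (*-comm (n / 2) 2) (m/n*n≤m n 2))
  ; bound = bound }
  where
  c = a ⊓ (n / 2)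
  a≤3c : a ≤ 3 * c
  a≤3c with a ≤? n / 2
  ... | yes a≤n/2 = subst (λ z → a ≤ 3 * z) (sym (m≤n⇒m⊓n≡m a≤n/2)) (m≤n*m a 3)
  ... | no a≰n/2 = subst (λ z → a ≤ 3 * z) (sym (m≥n⇒m⊓n≡n (<⇒≤ (≰⇒> a≰n/2)))) (≤-trans a≤n (n≤3*[n/2] n 2≤n))
  n≤156fc : n ≤ 156 * f * c
  n≤156fc = begin
    n                 ≤⟨ <⇒≤ n<52fa ⟩
    52 * f * a        ≤⟨ *-monoʳ-≤ (52 * f) a≤3c ⟩
    52 * f * (3 * c)  ≡⟨ rearrange f c ⟩
    156 * f * c       ∎
    where
    open ≤-Reasoning
    rearrange : ∀ f c → 52 * f * (3 * c) ≡ 156 * f * c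
    rearrange = solve-∀
  bound : a * n ^ f ≤ K ^ (f + 1) * f ^ f * (c * 1) ^ (f + 1)
  bound = begin
    a * n ^ f                                ≤⟨ *-mono-≤ a≤3c (^-monoˡ-≤ f n≤156fc) ⟩
    3 * c * (156 * f * c) ^ f                ≡⟨ cong (3 * c *_) (trans (^-distribʳ-* (156 * f) c f) (cong (_* c ^ f) (^-distribʳ-* 156 f f))) ⟩
    3 * c * (156 ^ f * f ^ f * c ^ f)        ≡⟨ rearrange c (156 ^ f) (f ^ f) (c ^ f) ⟩
    3 * 156 ^ f * (f ^ f * (c * c ^ f))      ≤⟨ *-monoˡ-≤ (f ^ f * (c * c ^ f)) (*-mono-≤ (m≤m+n 3 205) (^-monoˡ-≤ f (m≤m+n 156 52))) ⟩
    208 * 208 ^ f * (f ^ f * (c * c ^ f))    ≡⟨ *-assoc (208 * 208 ^ f) (f ^ f) (c * c ^ f) ⟨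
    208 * 208 ^ f * f ^ f * (c * c ^ f)      ≡⟨ cong₂ (λ u v → u * f ^ f * v) (sym (m^[n+1]≡m*m^n 208 f))
                                                  (trans (sym (m^[n+1]≡m*m^n c f)) (cong (_^ (f + 1)) (sym (*-identityʳ c)))) ⟩
    K ^ (f + 1) * f ^ f * (c * 1) ^ (f + 1)  ∎
    where
    open ≤-Reasoning
    rearrange : ∀ c P Q R → 3 * c * (P * Q * R) ≡ 3 * P * (Q * (c * R))
    rearrange = solve-∀

-- Many vertices per terminal: X = n / (52 f a) leaves room for a gadgets of MixedBranching X.
module GadgetPlan (f₀ a₀ n : ℕ) (1≤X : 1 ≤ n / (52 * suc f₀ * suc a₀)) where

  f a X : ℕ
  f = suc f₀
  a = suc a₀
  X = n / (52 * f * a)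

  ⌊X^[1/[1+f]]⌋ : Σ ℕ λ d → (1 ≤ d) × (d ^ suc f ≤ X) × (X < suc d ^ suc f)
  ⌊X^[1/[1+f]]⌋ = integer-root f X 1≤X

  d : ℕ
  d = proj₁ ⌊X^[1/[1+f]]⌋

  1≤d : 1 ≤ d
  1≤d = proj₁ (proj₂ ⌊X^[1/[1+f]]⌋)

  module M = MixedBranching f d X 1≤d (proj₁ (proj₂ (proj₂ ⌊X^[1/[1+f]]⌋))) (proj₂ (proj₂ (proj₂ ⌊X^[1/[1+f]]⌋)))

  L : ℕ
  L = product M.branching

  1≤fd : 1 ≤ f * d
  1≤fd = *-mono-≤ {1} {f} {1} {d} (s≤s z≤n) 1≤d

  1+6*sum≤13fd : 1 + 6 * sum M.branching ≤ 13 * (f * d)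
  1+6*sum≤13fd = begin
    1 + 6 * sum M.branching      ≤⟨ +-monoʳ-≤ 1 (*-monoʳ-≤ 6 M.sum-branching≤) ⟩
    1 + 6 * (f * suc d)          ≡⟨ rearrange f d ⟩
    1 + 6 * (f * d) + 6 * f      ≤⟨ +-mono-≤ (+-monoˡ-≤ (6 * (f * d)) 1≤fd) (*-monoʳ-≤ 6 (subst (_≤ f * d) (*-identityʳ f) (*-monoʳ-≤ f 1≤d))) ⟩
    f * d + 6 * (f * d) + 6 * (f * d) ≡⟨ rearrange′ (f * d) ⟩
    13 * (f * d)                 ∎
    where
    open ≤-Reasoning
    rearrange : ∀ f d → 1 + 6 * (f * suc d) ≡ 1 + 6 * (f * d) + 6 * f
    rearrange = solve-∀
    rearrange′ : ∀ x → x + 6 * x + 6 * x ≡ 13 * x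
    rearrange′ = solve-∀

  fits : 2 * (size M.branching * a) ≤ n
  fits = begin
    2 * (size M.branching * a)       ≤⟨ *-monoʳ-≤ 2 (*-monoˡ-≤ a (≤-trans (size≤ M.branching M.branching-positive) (*-monoʳ-≤ L 1+6*sum≤13fd))) ⟩
    2 * (L * (13 * (f * d)) * a)     ≡⟨ rearrange L f d a ⟩
    26 * f * a * (L * d)             ≤⟨ *-monoʳ-≤ (26 * f * a) M.product-branching*d≤X ⟩
    26 * f * a * X                   ≤⟨ *-monoˡ-≤ X (*-monoˡ-≤ a (*-monoˡ-≤ f (m≤m+n 26 26))) ⟩
    52 * f * a * X                   ≡⟨ *-comm (52 * f * a) X ⟩
    X * (52 * f * a)                 ≤⟨ m/n*n≤m n (52 * f * a) ⟩
    n                                ∎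
    where
    open ≤-Reasoning
    rearrange : ∀ L f d a → 2 * (L * (13 * (f * d)) * a) ≡ 26 * f * a * (L * d)
    rearrange = solve-∀

  n≤104faX : n ≤ 104 * f * a * X
  n≤104faX = begin
    n                       ≤⟨ <⇒≤ (m<[1+m/n]*n n (52 * f * a)) ⟩
    suc X * (52 * f * a)    ≤⟨ *-monoˡ-≤ (52 * f * a) (subst (suc X ≤_) (cong (X +_) (sym (+-identityʳ X))) (+-monoˡ-≤ X 1≤X)) ⟩
    2 * X * (52 * f * a)    ≡⟨ rearrange X f a ⟩
    104 * f * a * X         ∎
    where
    open ≤-Reasoning
    rearrange : ∀ X f a → 2 * X * (52 * f * a) ≡ 104 * f * a * X
    rearrange = solve-∀

  bound : a * n ^ f ≤ K ^ (f + 1) * f ^ f * (a * L) ^ (f + 1)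
  bound = begin
    a * n ^ f                                          ≤⟨ *-monoʳ-≤ a (^-monoˡ-≤ f n≤104faX) ⟩
    a * (104 * f * a * X) ^ f                          ≡⟨ cong (a *_) (trans (^-distribʳ-* (104 * f * a) X f)
                                                            (cong (_* X ^ f) (trans (^-distribʳ-* (104 * f) a f) (cong (_* a ^ f) (^-distribʳ-* 104 f f))))) ⟩
    a * (104 ^ f * f ^ f * a ^ f * X ^ f)              ≤⟨ *-monoʳ-≤ a (*-monoʳ-≤ (104 ^ f * f ^ f * a ^ f) M.X^f≤product^[1+f]*2^[1+f]) ⟩
    a * (104 ^ f * f ^ f * a ^ f * (L ^ suc f * (2 * 2 ^ f))) ≡⟨ rearrange a (104 ^ f) (f ^ f) (a ^ f) (L ^ suc f) (2 ^ f) ⟩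
    2 * (104 ^ f * 2 ^ f) * (f ^ f * ((a * a ^ f) * L ^ suc f)) ≡⟨ cong (λ z → 2 * z * (f ^ f * ((a * a ^ f) * L ^ suc f))) (^-distribʳ-* 104 2 f) ⟨
    2 * 208 ^ f * (f ^ f * ((a * a ^ f) * L ^ suc f))  ≤⟨ *-monoˡ-≤ (f ^ f * ((a * a ^ f) * L ^ suc f)) (*-monoˡ-≤ (208 ^ f) (m≤m+n 2 206)) ⟩
    208 * 208 ^ f * (f ^ f * ((a * a ^ f) * L ^ suc f)) ≡⟨ *-assoc (208 * 208 ^ f) (f ^ f) _ ⟨
    208 * 208 ^ f * f ^ f * ((a * a ^ f) * L ^ suc f)  ≡⟨ cong₂ (λ u v → u * f ^ f * v) (sym (m^[n+1]≡m*m^n 208 f)) a^[1+f]*L^[1+f] ⟩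
    K ^ (f + 1) * f ^ f * (a * L) ^ (f + 1)            ∎
    where
    open ≤-Reasoning
    rearrange : ∀ a P Q R S T → a * (P * Q * R * (S * (2 * T))) ≡ 2 * (P * T) * (Q * ((a * R) * S))
    rearrange = solve-∀
    a^[1+f]*L^[1+f] : (a * a ^ f) * L ^ suc f ≡ (a * L) ^ (f + 1)
    a^[1+f]*L^[1+f] = trans (sym (^-distribʳ-* a L (suc f))) (cong ((a * L) ^_) (+-comm 1 f))

plan-gadgets : ∀ f₀ a₀ n → 1 ≤ n / (52 * suc f₀ * suc a₀) → Plan (suc f₀) n (suc a₀)
plan-gadgets f₀ a₀ n 1≤X = record
  { copies = a ; branching = M.branching ; copies≤ = ≤-refl ; length≤ = ≤-reflexive M.length-branching
  ; positive = M.branching-positive ; fits = fits ; bound = bound }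
  where open GadgetPlan f₀ a₀ n 1≤X

plan : ∀ f n a → 1 ≤ f → 2 ≤ n → a ≤ n → Plan f n a
plan f n zero _ _ _ = plan-none f n
plan (suc f₀) n (suc a₀) _ 2≤n a≤n with n / (52 * suc f₀ * suc a₀) ≟ 0
... | yes X≡0 = plan-trivial (suc f₀) n (suc a₀) 2≤n a≤n (m/n≡0⇒m<n X≡0)
... | no X≢0 = plan-gadgets f₀ a₀ n (n≢0⇒n>0 X≢0)

-- The lower bound

initial : ∀ n → ℕ → Subset n
initial zero _ = []
initial (suc n) zero = outside ∷ initial n zero
initial (suc n) (suc s) = inside ∷ initial n s

∣initial∣ : ∀ n s → s ≤ n → ∣ initial n s ∣ ≡ s
∣initial∣ zero zero _ = refl
∣initial∣ (suc n) zero _ = ∣initial∣ n zero z≤n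
∣initial∣ (suc n) (suc s) (s≤s s≤n) = cong suc (∣initial∣ n s s≤n)

∈-initial : ∀ {n s} (u : Fin n) → toℕ u < s → u ∈ₛ initial n s
∈-initial {suc n} {suc s} zero _ = here
∈-initial {suc n} {suc s} (suc u) (s≤s u<s) = there (∈-initial u u<s)

∉-initial : ∀ {n s} (u : Fin n) → s ≤ toℕ u → u ∉ₛ initial n s
∉-initial {suc n} {zero} zero _ ()
∉-initial {suc n} {zero} (suc u) _ (there p) = ∉-initial u z≤n p
∉-initial {suc n} {suc s} (suc u) (s≤s s≤u) (there p) = ∉-initial u s≤u p

two-sided-bound : ∀ f n σ τ P Q E →
  σ * n ^ f ≤ K ^ (f + 1) * f ^ f * P ^ (f + 1) → τ * n ^ f ≤ K ^ (f + 1) * f ^ f * Q ^ (f + 1) → P * Q ≤ E →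
  σ * τ * n ^ (2 * f) ≤ (K * K) ^ (f + 1) * f ^ (2 * f) * E ^ (f + 1)
two-sided-bound f n σ τ P Q E σ-bound τ-bound PQ≤E = begin
  σ * τ * n ^ (2 * f)                              ≡⟨ cong (σ * τ *_) (^-double n) ⟩
  σ * τ * (n ^ f * n ^ f)                          ≡⟨ [m*n]*[o*p]≡[m*o]*[n*p] σ τ (n ^ f) (n ^ f) ⟩
  (σ * n ^ f) * (τ * n ^ f)                        ≤⟨ *-mono-≤ σ-bound τ-bound ⟩
  (C * f ^ f * P ^ (f + 1)) * (C * f ^ f * Q ^ (f + 1)) ≡⟨ rearrange C (f ^ f) (P ^ (f + 1)) (Q ^ (f + 1)) ⟩
  (C * C) * (f ^ f * f ^ f) * (P ^ (f + 1) * Q ^ (f + 1))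
      ≡⟨ cong₂ (λ u v → u * v * (P ^ (f + 1) * Q ^ (f + 1))) (sym (^-distribʳ-* K K (f + 1))) (sym (^-double f)) ⟩
  (K * K) ^ (f + 1) * f ^ (2 * f) * (P ^ (f + 1) * Q ^ (f + 1))
      ≡⟨ cong ((K * K) ^ (f + 1) * f ^ (2 * f) *_) (^-distribʳ-* P Q (f + 1)) ⟨
  (K * K) ^ (f + 1) * f ^ (2 * f) * (P * Q) ^ (f + 1)
      ≤⟨ *-monoʳ-≤ ((K * K) ^ (f + 1) * f ^ (2 * f)) (^-monoˡ-≤ (f + 1) PQ≤E) ⟩
  (K * K) ^ (f + 1) * f ^ (2 * f) * E ^ (f + 1)    ∎
  where
  open ≤-Reasoning
  C = K ^ (f + 1)
  ^-double : ∀ m → m ^ (2 * f) ≡ m ^ f * m ^ f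
  ^-double m = trans (cong (λ z → m ^ (f + z)) (+-identityʳ f)) (^-distribˡ-+-* m f f)
  rearrange : ∀ k g p q → (k * g * p) * (k * g * q) ≡ (k * k) * (g * g) * (p * q)
  rearrange = solve-∀

module Construction (f n σ τ : ℕ) (1≤f : 1 ≤ f) (2≤n : 2 ≤ n) (σ≤n : σ ≤ n) (τ≤n : τ ≤ n) where

  module SPlan = Plan (plan f n σ 1≤f 2≤n σ≤n)
  module TPlan = Plan (plan f n τ 1≤f 2≤n τ≤n)

  fits : size SPlan.branching * SPlan.copies + size TPlan.branching * TPlan.copies ≤ n
  fits = *-cancelˡ-≤ 2 (begin
    2 * (size SPlan.branching * SPlan.copies + size TPlan.branching * TPlan.copies)
      ≡⟨ *-distribˡ-+ 2 (size SPlan.branching * SPlan.copies) _ ⟩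
    2 * (size SPlan.branching * SPlan.copies) + 2 * (size TPlan.branching * TPlan.copies)
      ≤⟨ +-mono-≤ SPlan.fits TPlan.fits ⟩
    n + n ≡⟨ cong (n +_) (+-identityʳ n) ⟨
    2 * n ∎)
    where open ≤-Reasoning

  open HostGraph n SPlan.copies TPlan.copies SPlan.branching TPlan.branching fits public

  S T : Subset n
  S = initial n σ
  T = ∁ (initial n (n ∸ τ))

  ∣S∣≡σ : ∣ S ∣ ≡ σ
  ∣S∣≡σ = ∣initial∣ n σ σ≤n

  ∣T∣≡τ : ∣ T ∣ ≡ τ
  ∣T∣≡τ = trans (∣∁p∣≡n∸∣p∣ (initial n (n ∸ τ))) (trans (cong (n ∸_) (∣initial∣ n (n ∸ τ) (m∸n≤m n τ))) (m∸[m∸n]≡n τ≤n))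

  left-tops∈S : ∀ i → index (left i (top SPlan.branching)) ∈ₛ S
  left-tops∈S i = ∈-initial _ (subst (_< σ) (sym (toℕ-index-left-top i)) (<-≤-trans (toℕ<n i) SPlan.copies≤))

  right-tops∈T : ∀ j → index (right j (top TPlan.branching)) ∈ₛ T
  right-tops∈T j = x∉p⇒x∈∁p (∉-initial _ (begin
    n ∸ τ                        ≤⟨ ∸-monoʳ-≤ n (≤-trans (toℕ<n j) TPlan.copies≤) ⟩
    n ∸ suc (toℕ j)              ≡⟨ cong (_∸ suc (toℕ j)) (toℕ-index-right-top j) ⟨
    v + suc (toℕ j) ∸ suc (toℕ j) ≡⟨ m+n∸n≡m v (suc (toℕ j)) ⟩
    v                            ∎))
    where
    open ≤-Reasoning
    v = toℕ (index (right j (top TPlan.branching)))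

  few-cuts : length SPlan.branching + length TPlan.branching ≤ 2 * f
  few-cuts = subst (length SPlan.branching + length TPlan.branching ≤_) (cong (f +_) (sym (+-identityʳ f))) (+-mono-≤ SPlan.length≤ TPlan.length≤)

  open Spanners (2 * f) few-cuts S T left-tops∈S right-tops∈T

  spanner-size : ∀ H → IsFTAdditiveSTSpanner host H (2 * f) 1 S T →
                 σ * τ * n ^ (2 * f) ≤ (K * K) ^ (f + 1) * f ^ (2 * f) * ∣E∣ H ^ (f + 1)
  spanner-size H spanner = two-sided-bound f n σ τ _ _ (∣E∣ H) SPlan.bound TPlan.bound (crossings≤∣E∣ H spanner)

theorem10 : Σ ℕ λ c₁ → Σ ℕ λ c₂ → Σ ℕ λ N → (0 < c₁) × (0 < c₂) ×
    (∀ (f n σ τ : ℕ) → 1 ≤ f → N ≤ n → σ ≤ n → τ ≤ n →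
      Σ (Graph n) λ G → Σ (Subset n) λ S → Σ (Subset n) λ T →
        (∣ S ∣ ≡ σ) × (∣ T ∣ ≡ τ) ×
        (∀ (H : Graph n) → IsFTAdditiveSTSpanner G H (2 * f) 1 S T →
          c₁ ^ (f + 1) * σ * τ * n ^ (2 * f) ≤ c₂ ^ (f + 1) * f ^ (2 * f) * ∣E∣ H ^ (f + 1)))
theorem10 = 1 , K * K , 2 , s≤s z≤n , s≤s z≤n , λ f n σ τ 1≤f 2≤n σ≤n τ≤n →
  let open Construction f n σ τ 1≤f 2≤n σ≤n τ≤n in
  host , S , T , ∣S∣≡σ , ∣T∣≡τ , λ H spanner →
    ≤-trans (≤-reflexive (cong (λ c → c * τ * n ^ (2 * f)) (1^k*m≡m (f + 1) σ))) (spanner-size H spanner)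
  where
  1^k*m≡m : ∀ k m → 1 ^ k * m ≡ m
  1^k*m≡m k m = trans (cong (_* m) (^-zeroˡ k)) (*-identityˡ m)
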